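{- For every plane partition $\pi$, $F_\pi(q,t)=\Phi_\pi(q,t)$.
   Context: A plane partition is an array $\pi=(\pi(i,j))_{i,j\ge1}$ of nonnegative integers, finitely many nonzero, nonincreasing along rows and columns; its support is the set of boxes with $\pi(i,j)>0$. Definition of $F_\pi$: for nonnegative integers $n,m$ let $f(n,m)=\prod_{i=0}^{n-1}\frac{1-q^{i}t^{m+1}}{1-q^{i+1}t^{m}}$ for $n\ge1$ and $f(0,m)=1$; for a box $(i,j)$ in the support let $\lambda=(\pi(i,j),\pi(i+1,j+1),\dots)$, $\mu=(\pi(i+1,j),\pi(i+2,j+1),\dots)$, $\nu=(\pi(i,j+1),\pi(i+1,j+2),\dots)$, $F_\pi(i,j)(q,t)=\prod_{m\ge0}\frac{f(\lambda_1-\mu_{m+1},m)f(\lambda_1-\nu_{m+1},m)}{f(\lambda_1-\lambda_{m+1},m)f(\lambda_1-\lambda_{m+2},m)}$, and $F_\pi=\prod_{(i,j)\in\text{support}}F_\pi(i,j)$. Definition of $\Phi_\pi$: the diagonal partitions are $\lambda^k=(\pi(1,1+k),\pi(2,2+k),\dots)$ for $k\ge0$ and $\lambda^k=(\pi(1-k,1),\pi(2-k,2),\dots)$ for $k<0$; $[\alpha/\beta]$ denotes $\alpha/\beta$ if $\alpha\supset\beta$ and $\beta/\alpha$ if $\beta\supset\alpha$. For a partition $\lambda$ and box $s$ with arm length $a_\lambda(s)$ and leg length $l_\lambda(s)$, $b_\lambda(s)=\frac{1-q^{a_\lambda(s)}t^{l_\lambda(s)+1}}{1-q^{a_\lambda(s)+1}t^{l_\lambda(s)}}$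 if $s\in\lambda$, $b_\lambda(s)=1$ otherwise; $b_\lambda=\prod_{s\in\lambda}b_\lambda(s)$; for a horizontal strip $\lambda/\mu$, $\varphi_{\lambda/\mu}=\prod_{s\in C_{\lambda/\mu}}b_\lambda(s)/b_\mu(s)$ with $C_{\lambda/\mu}$ the union of columns intersecting $\lambda/\mu$. Then $\Phi_\pi=\frac{1}{b_{\lambda^0}}\prod_{n\in\mathbb{Z}}\varphi_{[\lambda^{n-1}/\lambda^n]}$. -}

module Defs where

open import Data.Nat as ℕ using (ℕ; zero; suc; _+_; _∸_; _≤_; _≤ᵇ_; _<ᵇ_; _≡ᵇ_)
open import Data.Integer as ℤ using (ℤ; +_; -[1+_]; 0ℤ; 1ℤ)
open import Data.Bool using (Bool; true; false; if_then_else_; _∧_)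
open import Data.List using (List; []; _∷_; _++_; map; foldr; upTo; concatMap)
open import Data.Bool.ListAction using (and; or)
open import Data.Product using (_×_; _,_)
open import Data.Sum using (_⊎_)
open import Relation.Binary.PropositionalEquality using (_≡_)

-- Polynomials in ℤ[q,t]: a list of terms  c · q^x t^y  (not normalised);
-- two polynomials are equal iff all their coefficients agree.

Poly : Set
Poly = List (ℤ × ℕ × ℕ)

coeff : Poly → ℕ → ℕ → ℤ
coeff p x y = foldr (λ { (c , a , b) acc → (if (a ≡ᵇ x) ∧ (b ≡ᵇ y) then c else 0ℤ) ℤ.+ acc }) 0ℤ p

mulFactor : ℕ × ℕ → Poly → Poly
mulFactor (a , b) p = p ++ map (λ { (c , x , y) → (ℤ.- c , x + a , y + b) }) p

factorsPoly : List (ℕ × ℕ) → Poly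
factorsPoly = foldr mulFactor ((1ℤ , 0 , 0) ∷ [])

-- Rational functions of the form ∏(1 - q^a t^b) / ∏(1 - q^c t^d),
-- where every factor used below has (a,b) ≠ (0,0), hence is nonzero.

record Frac : Set where
  constructor _/ₓ_
  field
    num : List (ℕ × ℕ)
    den : List (ℕ × ℕ)
open Frac public

oneF : Frac
oneF = [] /ₓ []

_⊗_ : Frac → Frac → Frac
(a /ₓ b) ⊗ (c /ₓ d) = (a ++ c) /ₓ (b ++ d)

invF : Frac → Frac
invF (a /ₓ b) = b /ₓ a

prodF : List Frac → Frac
prodF = foldr _⊗_ oneF

-- equality in ℚ(q,t):  N₁/D₁ = N₂/D₂  iff  N₁ D₂ = N₂ D₁ in ℤ[q,t]
_≈F_ : Frac → Frac → Set
F ≈F G = ∀ x y → coeff (factorsPoly (num F ++ den G)) x y ≡ coeff (factorsPoly (num G ++ den F)) x y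

-- Plane partitions.  π i j (0-indexed) stands for the paper's π(i+1,j+1).
-- N bounds the support: π i j = 0 whenever i ≥ N or j ≥ N.

record PlanePartition : Set where
  field
    π      : ℕ → ℕ → ℕ
    N      : ℕ
    rowDec : ∀ i j → π i (suc j) ≤ π i j
    colDec : ∀ i j → π (suc i) j ≤ π i j
    finite : ∀ i j → (N ≤ i ⊎ N ≤ j) → π i j ≡ 0
open PlanePartition public

fF : ℕ → ℕ → Frac
fF n m = map (λ i → (i , suc m)) (upTo n) /ₓ map (λ i → (suc i , m)) (upTo n)

ifPos : ℕ → Frac → Frac
ifPos zero    _ = oneF
ifPos (suc _) x = x

-- the factor F_π(i,j) (0-indexed box); λ_{k+1}, μ_{k+1}, ν_{k+1} as in the paper.
-- The product over m ≥ 0 is truncated at m < N: for m ≥ N all four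
-- entries vanish and the m-th factor is literally f(λ₁,m)²/f(λ₁,m)² = 1.
Fbox : PlanePartition → ℕ → ℕ → Frac
Fbox P i j = prodF (map factor (upTo (N P)))
  where
  lam mu nu : ℕ → ℕ
  lam k = π P (i + k) (j + k)
  mu  k = π P (suc i + k) (j + k)
  nu  k = π P (i + k) (suc j + k)
  l1 = lam 0
  factor : ℕ → Frac
  factor m = (fF (l1 ∸ mu m) m ⊗ fF (l1 ∸ nu m) m)
             ⊗ invF (fF (l1 ∸ lam m) m ⊗ fF (l1 ∸ lam (suc m)) m)

Fπ : PlanePartition → Frac
Fπ P = prodF (concatMap (λ i → map (λ j → ifPos (π P i j) (Fbox P i j)) (upTo (N P))) (upTo (N P)))

-- A partition is given as a function ℕ → ℕ (row r, 0-indexed,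
-- i.e. λ r = λ_{r+1}) together with the row bound N and column bound M
-- of the plane partition (all parts vanish for r ≥ N and are ≤ M = π(1,1)).

diag : PlanePartition → ℤ → ℕ → ℕ
diag P (+ k)     r = π P r (k + r)
diag P -[1+ k ] r = π P (suc k + r) r

module _ (Nr M : ℕ) where
  rows : List ℕ
  rows = upTo Nr
  cols : List ℕ
  cols = map suc (upTo M)

  conj : (ℕ → ℕ) → ℕ → ℕ
  conj lam c = foldr (λ r acc → (if c ≤ᵇ lam r then 1 else 0) + acc) 0 rows

  -- b_λ(s) for s = (row r (0-indexed), column c (1-indexed))
  bBox : (ℕ → ℕ) → ℕ → ℕ → Frac
  bBox lam r c = if c ≤ᵇ lam r
                 then ((arm , suc leg) ∷ []) /ₓ ((suc arm , leg) ∷ [])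
                 else oneF
    where
    arm = lam r ∸ c
    leg = conj lam c ∸ suc r

  bPart : (ℕ → ℕ) → Frac
  bPart lam = prodF (concatMap (λ r → map (λ c → bBox lam r c) cols) rows)

  contains : (ℕ → ℕ) → (ℕ → ℕ) → Bool
  contains α β = and (map (λ r → β r ≤ᵇ α r) rows)

  φ : (ℕ → ℕ) → (ℕ → ℕ) → Frac
  φ lam mu = prodF (concatMap colFactor cols)
    where
    inSkewCol : ℕ → Bool
    inSkewCol c = or (map (λ r → (mu r <ᵇ c) ∧ (c ≤ᵇ lam r)) rows)
    colFactor : ℕ → List Frac
    colFactor c = if inSkewCol c
                  then map (λ r → bBox lam r c ⊗ invF (bBox mu r c)) rows
                  else []

  φbr : (ℕ → ℕ) → (ℕ → ℕ) → Frac
  φbr α β = if contains α β then φ α β else φ β α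

-- Φ_π = (1/b_{λ⁰}) ∏_{n ∈ ℤ} φ_{[λ^{n-1}/λ^n]}; the product is over
-- -(N+1) ≤ n ≤ N+1; outside this range λ^{n-1} = λ^n = ∅ and the factor is 1.
Φπ : PlanePartition → Frac
Φπ P = invF (bPart Nr M (diag P (+ 0))) ⊗ prodF (map term ns)
  where
  Nr = N P
  M  = π P 0 0
  ns : List ℤ
  ns = map +_ (upTo (suc (suc Nr))) ++ map -[1+_] (upTo (suc Nr))
  term : ℤ → Frac
  term n = φbr Nr M (diag P (n ℤ.- 1ℤ)) (diag P n)

module Submission where

-- Both sides are quotients of products of factors (1 - q^a t^b).  Such
-- quotients are equal as soon as every factor (1 - q^x t^y) occurs with the
-- same exponent (numerator count minus denominator count) on both sides
-- (sections 2-3).  Exponents are additive, so, for a fixed (x , y), the theorem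
-- becomes an identity between finite integer sums (sections 4-6).
--
-- Let w(a , l) be the exponent of the hook factor
-- (1 - q^a t^{l+1}) / (1 - q^{a+1} t^l).  Then b_λ(s) has exponent
-- w(arm , leg), and f(n , m) has exponent Σ_{a<n} w(a , m).
--   * Φ_π (section 9): b_{λ⁰} and each φ_{[λ^{n-1}/λ^n]} split into columns;
--     a column c+1 of a strip factor contributes the difference of the column
--     exponents of the two diagonal partitions, if it meets the strip.
--   * F_π (sections 10-12): the box (i , j) sits in some row r of the diagonal
--     partition D through it, and F_π(i , j) has exponent
--     Σ_c K(c) · (exponent of b_D(r , c+1)), where the sign K(c) only depends
--     on which neighbouring strips meet column c+1 (sections 7-8).
--   * Summing over all boxes diagonal by diagonal, both sides become sums over
--     columns, and each column agrees by Abel summation (section 13).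

open import Defs

open import Data.Bool using (Bool; true; false; if_then_else_; _∧_; not; T)
open import Data.Bool.ListAction using (and; or)
open import Data.Bool.Properties using (T-≡; ∧-zeroʳ)
open import Data.Empty using (⊥-elim)
open import Data.Integer as ℤ using (ℤ; -[1+_]; 0ℤ; 1ℤ)
import Data.Integer.Properties as ℤP
open import Data.Integer.Tactic.RingSolver using (solve-∀)
open import Data.List using (List; []; _∷_; _++_; map; foldr; upTo; applyUpTo; concatMap)
open import Data.List.Properties using (map-++; map-cong; map-applyUpTo)
open import Data.Nat as ℕ using (ℕ; zero; suc; _+_; _∸_; _≤_; _<_; z≤n; s≤s; _≤ᵇ_; _<ᵇ_; _≡ᵇ_)
import Data.Nat.Properties as ℕP
open import Data.Product using (_×_; _,_; Σ-syntax; proj₁; proj₂; uncurry)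
open import Data.Sum using (_⊎_; inj₁; inj₂)
open import Function using (_∘_; Equivalence)
open import Relation.Binary using (tri<; tri≈; tri>)
open import Relation.Binary.PropositionalEquality
open import Relation.Nullary using (yes; no)

module Indicators where

  ind : Bool → ℤ
  ind true = 1ℤ
  ind false = 0ℤ

  ind-not : ∀ b → ind (not b) ≡ 1ℤ ℤ.- ind b
  ind-not true = refl
  ind-not false = refl

  ≤ᵇ-suc : ∀ a c → (a ≤ᵇ c) ≡ (suc a ≤ᵇ suc c)
  ≤ᵇ-suc zero c = refl
  ≤ᵇ-suc (suc a) c = refl

  false≢true : ∀ {A : Set} → false ≡ true → A
  false≢true ()

  T⇒≡true : ∀ {b} → T b → b ≡ true
  T⇒≡true = Equivalence.to T-≡

  ≡true⇒T : ∀ {b} → b ≡ true → T b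
  ≡true⇒T = Equivalence.from T-≡

  ≤ᵇ-true : ∀ {a c} → a ≤ c → (a ≤ᵇ c) ≡ true
  ≤ᵇ-true a≤c = T⇒≡true (ℕP.≤⇒≤ᵇ a≤c)

  ≤ᵇ-sound : ∀ {a c} → (a ≤ᵇ c) ≡ true → a ≤ c
  ≤ᵇ-sound {a} {c} e = ℕP.≤ᵇ⇒≤ a c (≡true⇒T e)

  <ᵇ-true : ∀ {a c} → a < c → (a <ᵇ c) ≡ true
  <ᵇ-true a<c = T⇒≡true (ℕP.<⇒<ᵇ a<c)

  <ᵇ-sound : ∀ {a c} → (a <ᵇ c) ≡ true → a < c
  <ᵇ-sound {a} {c} e = ℕP.<ᵇ⇒< a c (≡true⇒T e)

  <ᵇ-false : ∀ {a c} → c ≤ a → (a <ᵇ c) ≡ false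
  <ᵇ-false {a} {c} c≤a with a <ᵇ c in e
  ... | true = ⊥-elim (ℕP.<⇒≱ (<ᵇ-sound e) c≤a)
  ... | false = refl

  <ᵇ-false-sound : ∀ {a c} → (a <ᵇ c) ≡ false → c ≤ a
  <ᵇ-false-sound e = ℕP.≮⇒≥ (λ a<c → false≢true (trans (sym e) (<ᵇ-true a<c)))

  <ᵇ-not-≤ᵇ : ∀ c a → (c <ᵇ a) ≡ not (a ≤ᵇ c)
  <ᵇ-not-≤ᵇ c zero = refl
  <ᵇ-not-≤ᵇ zero (suc a) = refl
  <ᵇ-not-≤ᵇ (suc c) (suc a) = trans (<ᵇ-not-≤ᵇ c a) (cong not (≤ᵇ-suc a c))

  ind-< : ∀ c a → ind (c <ᵇ a) ≡ 1ℤ ℤ.- ind (a ≤ᵇ c)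
  ind-< c a = trans (cong ind (<ᵇ-not-≤ᵇ c a)) (ind-not (a ≤ᵇ c))

  ≤ᵇ-antitone : ∀ {a b} c → a ≤ b → (b ≤ᵇ c) ≡ true → (a ≤ᵇ c) ≡ true
  ≤ᵇ-antitone c a≤b e = ≤ᵇ-true (ℕP.≤-trans a≤b (≤ᵇ-sound e))

  ⇔-bool : ∀ {a b : Bool} → (a ≡ true → b ≡ true) → (b ≡ true → a ≡ true) → a ≡ b
  ⇔-bool {true} {true} _ _ = refl
  ⇔-bool {true} {false} f _ = sym (f refl)
  ⇔-bool {false} {true} _ g = g refl
  ⇔-bool {false} {false} _ _ = refl

module FactorProducts where

  open Indicators using (≤ᵇ-suc)

  _≐_ : Poly → Poly → Set
  p ≐ p′ = ∀ x y → coeff p x y ≡ coeff p′ x y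

  shift : ℕ → ℕ → ℤ × ℕ × ℕ → ℤ × ℕ × ℕ
  shift a b (c , u , v) = (ℤ.- c , u + a , v + b)

  mulFactor-shift : ∀ a b p → mulFactor (a , b) p ≡ p ++ map (shift a b) p
  mulFactor-shift a b p = cong (p ++_) (map-cong (λ _ → refl) p)

  coeff-++ : ∀ p p′ x y → coeff (p ++ p′) x y ≡ coeff p x y ℤ.+ coeff p′ x y
  coeff-++ [] p′ x y = sym (ℤP.+-identityˡ _)
  coeff-++ ((c , a , b) ∷ p) p′ x y =
    trans (cong (λ z → hit ℤ.+ z) (coeff-++ p p′ x y)) (sym (ℤP.+-assoc hit (coeff p x y) (coeff p′ x y)))
    where hit = if (a ≡ᵇ x) ∧ (b ≡ᵇ y) then c else 0ℤ

  +-≡ᵇ : ∀ u a x → ((u + a) ≡ᵇ x) ≡ ((a ≤ᵇ x) ∧ (u ≡ᵇ (x ∸ a)))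
  +-≡ᵇ u zero x rewrite ℕP.+-identityʳ u = refl
  +-≡ᵇ u (suc a) zero rewrite ℕP.+-suc u a = refl
  +-≡ᵇ u (suc a) (suc x) rewrite ℕP.+-suc u a = trans (+-≡ᵇ u a x) (cong (_∧ (u ≡ᵇ (x ∸ a))) (≤ᵇ-suc a x))

  ∧-interchange : ∀ a b c d → ((a ∧ b) ∧ (c ∧ d)) ≡ ((a ∧ c) ∧ (b ∧ d))
  ∧-interchange true b true d = refl
  ∧-interchange true b false d = ∧-zeroʳ b
  ∧-interchange false b c d = refl

  coeff-shift : ∀ a b p x y → coeff (map (shift a b) p) x y ≡
    (if (a ≤ᵇ x) ∧ (b ≤ᵇ y) then ℤ.- coeff p (x ∸ a) (y ∸ b) else 0ℤ)
  coeff-shift a b [] x y with (a ≤ᵇ x) ∧ (b ≤ᵇ y)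
  ... | true = refl
  ... | false = refl
  coeff-shift a b ((c , u , v) ∷ p) x y =
    trans (cong (λ z → hit ℤ.+ z) (coeff-shift a b p x y)) (merge (coeff p (x ∸ a) (y ∸ b)))
    where
    hit = if ((u + a) ≡ᵇ x) ∧ ((v + b) ≡ᵇ y) then ℤ.- c else 0ℤ
    merge : ∀ R → hit ℤ.+ (if (a ≤ᵇ x) ∧ (b ≤ᵇ y) then ℤ.- R else 0ℤ)
                ≡ (if (a ≤ᵇ x) ∧ (b ≤ᵇ y)
                   then ℤ.- ((if (u ≡ᵇ (x ∸ a)) ∧ (v ≡ᵇ (y ∸ b)) then c else 0ℤ) ℤ.+ R) else 0ℤ)
    merge R rewrite +-≡ᵇ u a x | +-≡ᵇ v b y
                  | ∧-interchange (a ≤ᵇ x) (u ≡ᵇ (x ∸ a)) (b ≤ᵇ y) (v ≡ᵇ (y ∸ b))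
      with (a ≤ᵇ x) ∧ (b ≤ᵇ y)
    ... | false = refl
    ... | true with (u ≡ᵇ (x ∸ a)) ∧ (v ≡ᵇ (y ∸ b))
    ...   | true = sym (ℤP.neg-distrib-+ c R)
    ...   | false = sym (ℤP.neg-distrib-+ 0ℤ R)

  mulFactor-cong : ∀ f p p′ → p ≐ p′ → mulFactor f p ≐ mulFactor f p′
  mulFactor-cong (a , b) p p′ e x y = begin
      coeff (mulFactor (a , b) p) x y
    ≡⟨ cong (λ z → coeff z x y) (mulFactor-shift a b p) ⟩
      coeff (p ++ map (shift a b) p) x y
    ≡⟨ coeff-++ p _ x y ⟩
      coeff p x y ℤ.+ coeff (map (shift a b) p) x y
    ≡⟨ cong₂ ℤ._+_ (e x y) shifted ⟩
      coeff p′ x y ℤ.+ coeff (map (shift a b) p′) x y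
    ≡⟨ sym (coeff-++ p′ _ x y) ⟩
      coeff (p′ ++ map (shift a b) p′) x y
    ≡⟨ cong (λ z → coeff z x y) (sym (mulFactor-shift a b p′)) ⟩
      coeff (mulFactor (a , b) p′) x y
    ∎
    where
    open ≡-Reasoning
    shifted : coeff (map (shift a b) p) x y ≡ coeff (map (shift a b) p′) x y
    shifted = trans (coeff-shift a b p x y)
      (trans (cong (λ z → if (a ≤ᵇ x) ∧ (b ≤ᵇ y) then ℤ.- z else 0ℤ) (e (x ∸ a) (y ∸ b)))
             (sym (coeff-shift a b p′ x y)))

  shift-comm : ∀ a b c d p → map (shift a b) (map (shift c d) p) ≡ map (shift c d) (map (shift a b) p)
  shift-comm a b c d [] = refl
  shift-comm a b c d ((e , u , v) ∷ p) =
    cong₂ _∷_ (cong₂ (λ u′ v′ → (ℤ.- ℤ.- e , u′ , v′)) (swap+ u c a) (swap+ v d b)) (shift-comm a b c d p)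
    where
    swap+ : ∀ u c a → u + c + a ≡ u + a + c
    swap+ u c a = trans (ℕP.+-assoc u c a) (trans (cong (u +_) (ℕP.+-comm c a)) (sym (ℕP.+-assoc u a c)))

  -- Multiplications by two factors commute: both give p + p_f + p_g + p_fg.
  mulFactor-comm : ∀ f g p → mulFactor f (mulFactor g p) ≐ mulFactor g (mulFactor f p)
  mulFactor-comm (a , b) (c , d) p x y = begin
      coeff (mulFactor (a , b) (mulFactor (c , d) p)) x y
    ≡⟨ cong (λ z → coeff z x y) (expand a b c d) ⟩
      coeff ((p ++ pcd) ++ (pab ++ map (shift a b) pcd)) x y
    ≡⟨ cong (λ z → coeff ((p ++ pcd) ++ (pab ++ z)) x y) (shift-comm a b c d p) ⟩
      coeff ((p ++ pcd) ++ (pab ++ map (shift c d) pab)) x y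
    ≡⟨ split4 pcd pab (map (shift c d) pab) ⟩
      coeff p x y ℤ.+ coeff pcd x y ℤ.+ (coeff pab x y ℤ.+ coeff (map (shift c d) pab) x y)
    ≡⟨ middle-swap (coeff p x y) (coeff pcd x y) (coeff pab x y) _ ⟩
      coeff p x y ℤ.+ coeff pab x y ℤ.+ (coeff pcd x y ℤ.+ coeff (map (shift c d) pab) x y)
    ≡⟨ sym (split4 pab pcd (map (shift c d) pab)) ⟩
      coeff ((p ++ pab) ++ (pcd ++ map (shift c d) pab)) x y
    ≡⟨ cong (λ z → coeff z x y) (sym (expand c d a b)) ⟩
      coeff (mulFactor (c , d) (mulFactor (a , b) p)) x y
    ∎
    where
    open ≡-Reasoning
    pab = map (shift a b) p
    pcd = map (shift c d) p
    expand : ∀ a b c d → mulFactor (a , b) (mulFactor (c , d) p)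
           ≡ (p ++ map (shift c d) p) ++ (map (shift a b) p ++ map (shift a b) (map (shift c d) p))
    expand a b c d =
      trans (mulFactor-shift a b (mulFactor (c , d) p))
        (trans (cong (λ z → z ++ map (shift a b) z) (mulFactor-shift c d p))
               (cong ((p ++ map (shift c d) p) ++_) (map-++ (shift a b) p (map (shift c d) p))))
    split4 : ∀ p₁ p₂ p₃ → coeff ((p ++ p₁) ++ (p₂ ++ p₃)) x y
           ≡ coeff p x y ℤ.+ coeff p₁ x y ℤ.+ (coeff p₂ x y ℤ.+ coeff p₃ x y)
    split4 p₁ p₂ p₃ = trans (coeff-++ (p ++ p₁) _ x y) (cong₂ ℤ._+_ (coeff-++ p p₁ x y) (coeff-++ p₂ p₃ x y))
    middle-swap : ∀ P Q R S → P ℤ.+ Q ℤ.+ (R ℤ.+ S) ≡ P ℤ.+ R ℤ.+ (Q ℤ.+ S)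
    middle-swap = solve-∀

-- 3. A quotient of factor products is determined by the exponents of its
--    factors: if every (1 - q^x t^y) has the same exponent in F and G, then
--    F ≈F G.

module FactorCounting where

  open FactorProducts

  is : ℕ → ℕ → ℕ → ℕ → Bool
  is x y a b = (a ≡ᵇ x) ∧ (b ≡ᵇ y)

  occ : ℕ → ℕ → List (ℕ × ℕ) → ℕ
  occ x y [] = 0
  occ x y ((a , b) ∷ l) = (if is x y a b then 1 else 0) + occ x y l

  occ-++ : ∀ x y A B → occ x y (A ++ B) ≡ occ x y A + occ x y B
  occ-++ x y [] B = refl
  occ-++ x y ((a , b) ∷ A) B =
    trans (cong (_ +_) (occ-++ x y A B)) (sym (ℕP.+-assoc (if is x y a b then 1 else 0) (occ x y A) (occ x y B)))

  ≡ᵇ-refl : ∀ n → (n ≡ᵇ n) ≡ true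
  ≡ᵇ-refl zero = refl
  ≡ᵇ-refl (suc n) = ≡ᵇ-refl n

  is-refl : ∀ a b → is a b a b ≡ true
  is-refl a b rewrite ≡ᵇ-refl a | ≡ᵇ-refl b = refl

  is-sound : ∀ x y a b → is x y a b ≡ true → (a , b) ≡ (x , y)
  is-sound x y a b e with a ≡ᵇ x in e₁ | b ≡ᵇ y in e₂
  is-sound x y a b refl | true | true
    rewrite ℕP.≡ᵇ⇒≡ a x (subst T (sym e₁) _) | ℕP.≡ᵇ⇒≡ b y (subst T (sym e₂) _) = refl

  pick : ∀ x y L k → occ x y L ≡ suc k → Σ[ A ∈ List (ℕ × ℕ) ] Σ[ B ∈ List (ℕ × ℕ) ] L ≡ A ++ (x , y) ∷ B
  pick x y ((a , b) ∷ L) k e with is x y a b in eq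
  ... | true rewrite is-sound x y a b eq = [] , L , refl
  ... | false with pick x y L k e
  ...   | A , B , refl = (a , b) ∷ A , B , refl

  occ-middle : ∀ x y A f B → occ x y (A ++ f ∷ B) ≡ occ x y (f ∷ []) + occ x y (A ++ B)
  occ-middle x y A (a , b) B =
    trans (occ-++ x y A ((a , b) ∷ B))
      (trans (rearrange (occ x y A) (if is x y a b then 1 else 0) (occ x y B))
             (cong (_ +_) (sym (occ-++ x y A B))))
    where
    rearrange : ∀ m d n → m + (d + n) ≡ (d + 0) + (m + n)
    rearrange m d n rewrite ℕP.+-identityʳ d = trans (sym (ℕP.+-assoc m d n))
      (trans (cong (_+ n) (ℕP.+-comm m d)) (ℕP.+-assoc d m n))

  factorsPoly-middle : ∀ A f B → factorsPoly (A ++ f ∷ B) ≐ mulFactor f (factorsPoly (A ++ B))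
  factorsPoly-middle [] f B x y = refl
  factorsPoly-middle (g ∷ A) f B x y =
    trans (mulFactor-cong g (factorsPoly (A ++ f ∷ B)) (mulFactor f (factorsPoly (A ++ B))) (factorsPoly-middle A f B) x y) (mulFactor-comm g f (factorsPoly (A ++ B)) x y)

  factorsPoly-occ : ∀ L L′ → (∀ x y → occ x y L ≡ occ x y L′) → factorsPoly L ≐ factorsPoly L′
  factorsPoly-occ [] [] e x y = refl
  factorsPoly-occ [] ((a , b) ∷ L′) e with e a b
  ... | counts rewrite is-refl a b with counts
  ...   | ()
  factorsPoly-occ ((a , b) ∷ L) L′ e
    with pick a b L′ (occ a b L) (trans (sym (e a b)) (cong (λ z → (if z then 1 else 0) + occ a b L) (is-refl a b)))
  ... | A , B , refl = λ x y →
    trans (mulFactor-cong (a , b) (factorsPoly L) (factorsPoly (A ++ B)) (factorsPoly-occ L (A ++ B) rest) x y)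
          (sym (factorsPoly-middle A (a , b) B x y))
    where
    rest : ∀ x y → occ x y L ≡ occ x y (A ++ B)
    rest x y = ℕP.+-cancelˡ-≡ (occ x y ((a , b) ∷ [])) _ _
      (trans (cong (_+ occ x y L) (ℕP.+-identityʳ (if is x y a b then 1 else 0)))
             (trans (e x y) (occ-middle x y A (a , b) B)))

  exponent : ℕ → ℕ → Frac → ℤ
  exponent x y F = ℤ.+ occ x y (num F) ℤ.- ℤ.+ occ x y (den F)

  ≈F-by-exponent : ∀ F G → (∀ x y → exponent x y F ≡ exponent x y G) → F ≈F G
  ≈F-by-exponent F G e = factorsPoly-occ (num F ++ den G) (num G ++ den F) cross
    where
    cross : ∀ x y → occ x y (num F ++ den G) ≡ occ x y (num G ++ den F)
    cross x y rewrite occ-++ x y (num F) (den G) | occ-++ x y (num G) (den F) =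
      ℤP.+-injective (trans (regroup (ℤ.+ occ x y (num F)) (ℤ.+ occ x y (den F)) (ℤ.+ occ x y (den G)))
        (trans (cong (λ z → z ℤ.+ ℤ.+ occ x y (den G) ℤ.+ ℤ.+ occ x y (den F)) (e x y))
               (sym (regroup′ (ℤ.+ occ x y (num G)) (ℤ.+ occ x y (den G)) (ℤ.+ occ x y (den F))))))
      where
      regroup : ∀ n d d′ → n ℤ.+ d′ ≡ (n ℤ.- d) ℤ.+ d′ ℤ.+ d
      regroup = solve-∀
      regroup′ : ∀ n d d′ → n ℤ.+ d′ ≡ (n ℤ.- d) ℤ.+ d ℤ.+ d′
      regroup′ = solve-∀

module FiniteSums where

  ∑ : ℕ → (ℕ → ℤ) → ℤ
  ∑ zero f = 0ℤ
  ∑ (suc n) f = f 0 ℤ.+ ∑ n (f ∘ suc)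

  ∑-cong< : ∀ n {f g : ℕ → ℤ} → (∀ i → i < n → f i ≡ g i) → ∑ n f ≡ ∑ n g
  ∑-cong< zero e = refl
  ∑-cong< (suc n) e = cong₂ ℤ._+_ (e 0 (s≤s z≤n)) (∑-cong< n (λ i i<n → e (suc i) (s≤s i<n)))

  ∑-cong : ∀ n {f g : ℕ → ℤ} → (∀ i → f i ≡ g i) → ∑ n f ≡ ∑ n g
  ∑-cong n e = ∑-cong< n (λ i _ → e i)

  ∑-zero : ∀ n {f : ℕ → ℤ} → (∀ i → i < n → f i ≡ 0ℤ) → ∑ n f ≡ 0ℤ
  ∑-zero zero e = refl
  ∑-zero (suc n) e rewrite e 0 (s≤s z≤n) | ∑-zero n (λ i i<n → e (suc i) (s≤s i<n)) = refl

  ∑-+ : ∀ n (f g : ℕ → ℤ) → ∑ n (λ i → f i ℤ.+ g i) ≡ ∑ n f ℤ.+ ∑ n g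
  ∑-+ zero f g = refl
  ∑-+ (suc n) f g rewrite ∑-+ n (f ∘ suc) (g ∘ suc) = interchange (f 0) (g 0) (∑ n (f ∘ suc)) (∑ n (g ∘ suc))
    where
    interchange : ∀ a b c d → a ℤ.+ b ℤ.+ (c ℤ.+ d) ≡ a ℤ.+ c ℤ.+ (b ℤ.+ d)
    interchange = solve-∀

  ∑-* : ∀ n c (f : ℕ → ℤ) → ∑ n (λ i → c ℤ.* f i) ≡ c ℤ.* ∑ n f
  ∑-* zero c f = sym (ℤP.*-zeroʳ c)
  ∑-* (suc n) c f rewrite ∑-* n c (f ∘ suc) = sym (ℤP.*-distribˡ-+ c (f 0) _)

  ∑-neg : ∀ n (f : ℕ → ℤ) → ∑ n (λ i → ℤ.- f i) ≡ ℤ.- ∑ n f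
  ∑-neg zero f = refl
  ∑-neg (suc n) f rewrite ∑-neg n (f ∘ suc) = sym (ℤP.neg-distrib-+ (f 0) _)

  ∑-- : ∀ n (f g : ℕ → ℤ) → ∑ n (λ i → f i ℤ.- g i) ≡ ∑ n f ℤ.- ∑ n g
  ∑-- n f g = trans (∑-+ n f (λ i → ℤ.- g i)) (cong (λ z → ∑ n f ℤ.+ z) (∑-neg n g))

  ∑-last : ∀ n (f : ℕ → ℤ) → ∑ (suc n) f ≡ ∑ n f ℤ.+ f n
  ∑-last zero f = ℤP.+-comm (f 0) 0ℤ
  ∑-last (suc n) f rewrite ∑-last n (f ∘ suc) = sym (ℤP.+-assoc (f 0) _ _)

  ∑-split : ∀ a b (f : ℕ → ℤ) → ∑ (a + b) f ≡ ∑ a f ℤ.+ ∑ b (λ d → f (a + d))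
  ∑-split zero b f = sym (ℤP.+-identityˡ _)
  ∑-split (suc a) b f rewrite ∑-split a b (f ∘ suc) = sym (ℤP.+-assoc (f 0) _ _)

  ∑-swap : ∀ n m (f : ℕ → ℕ → ℤ) → ∑ n (λ i → ∑ m (f i)) ≡ ∑ m (λ j → ∑ n (λ i → f i j))
  ∑-swap zero m f = sym (∑-zero m (λ _ _ → refl))
  ∑-swap (suc n) m f rewrite ∑-swap n m (f ∘ suc) = sym (∑-+ m (f 0) (λ j → ∑ n (λ i → f (suc i) j)))

  ∑-extend : ∀ A B (f : ℕ → ℤ) → A ≤ B → (∀ i → A ≤ i → i < B → f i ≡ 0ℤ) → ∑ B f ≡ ∑ A f
  ∑-extend A B f A≤B e = begin
      ∑ B f                              ≡⟨ cong (λ n → ∑ n f) (sym (ℕP.m+[n∸m]≡n A≤B)) ⟩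
      ∑ (A + (B ∸ A)) f                  ≡⟨ ∑-split A (B ∸ A) f ⟩
      ∑ A f ℤ.+ ∑ (B ∸ A) (λ d → f (A + d)) ≡⟨ cong (λ z → ∑ A f ℤ.+ z) (∑-zero (B ∸ A) tail0) ⟩
      ∑ A f ℤ.+ 0ℤ                        ≡⟨ ℤP.+-identityʳ _ ⟩
      ∑ A f                              ∎
    where
    open ≡-Reasoning
    tail0 : ∀ d → d < B ∸ A → f (A + d) ≡ 0ℤ
    tail0 d d<B∸A = e (A + d) (ℕP.m≤m+n A d)
      (subst (A + d <_) (ℕP.m+[n∸m]≡n A≤B) (ℕP.+-monoʳ-< A d<B∸A))

  ∑-single : ∀ n i₀ (f : ℕ → ℤ) → i₀ < n → (∀ i → i < n → i ≢ i₀ → f i ≡ 0ℤ) → ∑ n f ≡ f i₀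
  ∑-single (suc n) zero f _ e =
    trans (cong (λ z → f 0 ℤ.+ z) (∑-zero n (λ i i<n → e (suc i) (s≤s i<n) (λ ())))) (ℤP.+-identityʳ _)
  ∑-single (suc n) (suc i₀) f (s≤s i₀<n) e =
    trans (cong₂ ℤ._+_ (e 0 (s≤s z≤n) (λ ()))
                        (∑-single n i₀ (f ∘ suc) i₀<n (λ i i<n i≢i₀ → e (suc i) (s≤s i<n) (i≢i₀ ∘ ℕP.suc-injective))))
          (ℤP.+-identityˡ _)

module Rearrangements where

  open FiniteSums

  -- Σ_{i<N} Σ_{j<i} H i j, re-indexed by the column j and the distance i - j - 1.
  ∑-triangle : ∀ N (H : ℕ → ℕ → ℤ) → ∑ N (λ i → ∑ i (H i)) ≡ ∑ N (λ j → ∑ (N ∸ suc j) (λ e → H (suc j + e) j))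
  ∑-triangle zero H = refl
  ∑-triangle (suc N) H = begin
      ∑ (suc N) (λ i → ∑ i (H i))
    ≡⟨ ∑-last N (λ i → ∑ i (H i)) ⟩
      ∑ N (λ i → ∑ i (H i)) ℤ.+ ∑ N (H N)
    ≡⟨ cong (ℤ._+ ∑ N (H N)) (∑-triangle N H) ⟩
      ∑ N (λ j → ∑ (N ∸ suc j) (column j)) ℤ.+ ∑ N (H N)
    ≡⟨ sym (∑-+ N _ _) ⟩
      ∑ N (λ j → ∑ (N ∸ suc j) (column j) ℤ.+ H N j)
    ≡⟨ ∑-cong< N (λ j j<N → sym (grow j j<N)) ⟩
      ∑ N (λ j → ∑ (N ∸ j) (column j))
    ≡⟨ sym (ℤP.+-identityʳ _) ⟩
      ∑ N (λ j → ∑ (N ∸ j) (column j)) ℤ.+ ∑ 0 (column N)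
    ≡⟨ cong (λ n → ∑ N (λ j → ∑ (N ∸ j) (column j)) ℤ.+ ∑ n (column N)) (sym (ℕP.n∸n≡0 N)) ⟩
      ∑ N (λ j → ∑ (N ∸ j) (column j)) ℤ.+ ∑ (N ∸ N) (column N)
    ≡⟨ sym (∑-last N (λ j → ∑ (suc N ∸ suc j) (column j))) ⟩
      ∑ (suc N) (λ j → ∑ (suc N ∸ suc j) (column j))
    ∎
    where
    open ≡-Reasoning
    column : ℕ → ℕ → ℤ
    column j e = H (suc j + e) j
    grow : ∀ j → j < N → ∑ (N ∸ j) (column j) ≡ ∑ (N ∸ suc j) (column j) ℤ.+ H N j
    grow j j<N = begin
        ∑ (N ∸ j) (column j)                          ≡⟨ cong (λ n → ∑ n (column j)) (ℕP.+-∸-assoc 1 j<N) ⟩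
        ∑ (suc (N ∸ suc j)) (column j)                ≡⟨ ∑-last (N ∸ suc j) (column j) ⟩
        ∑ (N ∸ suc j) (column j) ℤ.+ column j (N ∸ suc j) ≡⟨ cong (λ i → ∑ (N ∸ suc j) (column j) ℤ.+ H i j) (ℕP.m+[n∸m]≡n j<N) ⟩
        ∑ (N ∸ suc j) (column j) ℤ.+ H N j            ∎

  -- Summing an array supported in [0,N)² along its diagonals i - j = k ≥ 0
  -- ("upper") and j - i = k + 1 > 0 ("lower").
  ∑-diagonals : ∀ N (H : ℕ → ℕ → ℤ) → (∀ i j → N ≤ i ⊎ N ≤ j → H i j ≡ 0ℤ) →
    ∑ N (λ i → ∑ N (H i)) ≡ ∑ N (λ k → ∑ N (λ r → H r (k + r))) ℤ.+ ∑ N (λ k → ∑ N (λ r → H (suc k + r) r))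
  ∑-diagonals N H supported = begin
      ∑ N (λ i → ∑ N (H i))
    ≡⟨ ∑-cong< N split-row ⟩
      ∑ N (λ i → ∑ (N ∸ i) (λ d → H i (i + d)) ℤ.+ ∑ i (H i))
    ≡⟨ ∑-+ N _ _ ⟩
      ∑ N (λ i → ∑ (N ∸ i) (λ d → H i (i + d))) ℤ.+ ∑ N (λ i → ∑ i (H i))
    ≡⟨ cong₂ ℤ._+_ upper lower ⟩
      ∑ N (λ k → ∑ N (λ r → H r (k + r))) ℤ.+ ∑ N (λ k → ∑ N (λ r → H (suc k + r) r))
    ∎
    where
    open ≡-Reasoning
    split-row : ∀ i → i < N → ∑ N (H i) ≡ ∑ (N ∸ i) (λ d → H i (i + d)) ℤ.+ ∑ i (H i)
    split-row i i<N = trans (cong (λ n → ∑ n (H i)) (sym (ℕP.m+[n∸m]≡n (ℕP.<⇒≤ i<N))))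
      (trans (∑-split i (N ∸ i) (H i)) (ℤP.+-comm (∑ i (H i)) _))
    upper : ∑ N (λ i → ∑ (N ∸ i) (λ d → H i (i + d))) ≡ ∑ N (λ k → ∑ N (λ r → H r (k + r)))
    upper = trans (∑-cong N (λ i → sym (∑-extend (N ∸ i) N (λ d → H i (i + d)) (ℕP.m∸n≤m N i)
                     (λ d N∸i≤d _ → supported i (i + d) (inj₂ (ℕP.≤-trans (ℕP.m≤n+m∸n N i) (ℕP.+-monoʳ-≤ i N∸i≤d)))))))
            (trans (∑-swap N N (λ i d → H i (i + d)))
                   (∑-cong N (λ k → ∑-cong N (λ r → cong (H r) (ℕP.+-comm r k)))))
    lower : ∑ N (λ i → ∑ i (H i)) ≡ ∑ N (λ k → ∑ N (λ r → H (suc k + r) r))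
    lower = trans (∑-triangle N H)
      (trans (∑-cong N (λ j → sym (∑-extend (N ∸ suc j) N (λ e → H (suc j + e) j) (ℕP.m∸n≤m N (suc j))
                (λ e N∸sj≤e _ → supported (suc j + e) j (inj₁ (ℕP.≤-trans (ℕP.m≤n+m∸n N (suc j)) (ℕP.+-monoʳ-≤ (suc j) N∸sj≤e)))))))
        (trans (∑-swap N N (λ j e → H (suc j + e) j))
               (∑-cong N (λ k → ∑-cong N (λ r → cong (λ i → H (suc i) r) (ℕP.+-comm r k))))))

  abel : ∀ n (A a : ℕ → ℤ) → ∑ (suc n) (λ k → A k ℤ.* (a k ℤ.- a (suc k)))
    ≡ A 0 ℤ.* a 0 ℤ.+ ∑ n (λ k → (A (suc k) ℤ.- A k) ℤ.* a (suc k)) ℤ.- A n ℤ.* a (suc n)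
  abel zero A a = base (A 0) (a 0) (a 1)
    where
    base : ∀ p q r → p ℤ.* (q ℤ.- r) ℤ.+ 0ℤ ≡ p ℤ.* q ℤ.+ 0ℤ ℤ.- p ℤ.* r
    base = solve-∀
  abel (suc n) A a = begin
      ∑ (suc (suc n)) (λ k → A k ℤ.* (a k ℤ.- a (suc k)))
    ≡⟨ ∑-last (suc n) (λ k → A k ℤ.* (a k ℤ.- a (suc k))) ⟩
      ∑ (suc n) (λ k → A k ℤ.* (a k ℤ.- a (suc k))) ℤ.+ A (suc n) ℤ.* (a (suc n) ℤ.- a (suc (suc n)))
    ≡⟨ cong (ℤ._+ A (suc n) ℤ.* (a (suc n) ℤ.- a (suc (suc n)))) (abel n A a) ⟩
      A 0 ℤ.* a 0 ℤ.+ X ℤ.- A n ℤ.* a (suc n) ℤ.+ A (suc n) ℤ.* (a (suc n) ℤ.- a (suc (suc n)))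
    ≡⟨ step (A 0 ℤ.* a 0) X (A n) (A (suc n)) (a (suc n)) (a (suc (suc n))) ⟩
      A 0 ℤ.* a 0 ℤ.+ (X ℤ.+ (A (suc n) ℤ.- A n) ℤ.* a (suc n)) ℤ.- A (suc n) ℤ.* a (suc (suc n))
    ≡⟨ cong (λ z → A 0 ℤ.* a 0 ℤ.+ z ℤ.- A (suc n) ℤ.* a (suc (suc n))) (sym (∑-last n (λ k → (A (suc k) ℤ.- A k) ℤ.* a (suc k)))) ⟩
      A 0 ℤ.* a 0 ℤ.+ ∑ (suc n) (λ k → (A (suc k) ℤ.- A k) ℤ.* a (suc k)) ℤ.- A (suc n) ℤ.* a (suc (suc n))
    ∎
    where
    open ≡-Reasoning
    X = ∑ n (λ k → (A (suc k) ℤ.- A k) ℤ.* a (suc k))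
    step : ∀ p X An An₁ a₁ a₂ → p ℤ.+ X ℤ.- An ℤ.* a₁ ℤ.+ An₁ ℤ.* (a₁ ℤ.- a₂)
           ≡ p ℤ.+ (X ℤ.+ (An₁ ℤ.- An) ℤ.* a₁) ℤ.- An₁ ℤ.* a₂
    step = solve-∀

-- 6. Exponents of the building blocks, for a fixed factor (1 - q^x t^y).
--    exponent is a homomorphism from (Frac, ⊗, invF) to (ℤ, +, -), and the
--    basic quotient is the "hook factor" (1 - q^a t^{l+1}) / (1 - q^{a+1} t^l),
--    whose exponent is  w a l.

module BasicExponents (x y : ℕ) where

  open FactorCounting
  open FiniteSums

  ex : Frac → ℤ
  ex = exponent x y

  δ : ℕ → ℕ → ℤ
  δ a b = ℤ.+ (if is x y a b then 1 else 0)

  w : ℕ → ℕ → ℤ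
  w a l = δ a (suc l) ℤ.- δ (suc a) l

  ex-⊗ : ∀ F G → ex (F ⊗ G) ≡ ex F ℤ.+ ex G
  ex-⊗ F G rewrite occ-++ x y (num F) (num G) | occ-++ x y (den F) (den G) =
    regroup (ℤ.+ occ x y (num F)) (ℤ.+ occ x y (num G)) (ℤ.+ occ x y (den F)) (ℤ.+ occ x y (den G))
    where
    regroup : ∀ a b c d → (a ℤ.+ b) ℤ.- (c ℤ.+ d) ≡ (a ℤ.- c) ℤ.+ (b ℤ.- d)
    regroup = solve-∀

  ex-inv : ∀ F → ex (invF F) ≡ ℤ.- ex F
  ex-inv F = swap (ℤ.+ occ x y (num F)) (ℤ.+ occ x y (den F))
    where
    swap : ∀ a b → b ℤ.- a ≡ ℤ.- (a ℤ.- b)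
    swap = solve-∀

  ex-prodF-++ : ∀ A B → ex (prodF (A ++ B)) ≡ ex (prodF A) ℤ.+ ex (prodF B)
  ex-prodF-++ [] B = sym (ℤP.+-identityˡ _)
  ex-prodF-++ (F ∷ A) B = begin
      ex (F ⊗ prodF (A ++ B))                    ≡⟨ ex-⊗ F (prodF (A ++ B)) ⟩
      ex F ℤ.+ ex (prodF (A ++ B))               ≡⟨ cong (λ z → ex F ℤ.+ z) (ex-prodF-++ A B) ⟩
      ex F ℤ.+ (ex (prodF A) ℤ.+ ex (prodF B))   ≡⟨ sym (ℤP.+-assoc (ex F) _ _) ⟩
      ex F ℤ.+ ex (prodF A) ℤ.+ ex (prodF B)     ≡⟨ cong (λ z → z ℤ.+ ex (prodF B)) (sym (ex-⊗ F (prodF A))) ⟩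
      ex (F ⊗ prodF A) ℤ.+ ex (prodF B)          ∎
    where open ≡-Reasoning

  ex-prodF-map : ∀ {A : Set} (g : A → Frac) (f : ℕ → A) n → ex (prodF (map g (applyUpTo f n))) ≡ ∑ n (λ i → ex (g (f i)))
  ex-prodF-map g f zero = refl
  ex-prodF-map g f (suc n) = trans (ex-⊗ (g (f 0)) _) (cong (λ z → ex (g (f 0)) ℤ.+ z) (ex-prodF-map g (f ∘ suc) n))

  ex-prodF-concatMap : ∀ (h : ℕ → List Frac) f n →
    ex (prodF (concatMap h (applyUpTo f n))) ≡ ∑ n (λ i → ex (prodF (h (f i))))
  ex-prodF-concatMap h f zero = refl
  ex-prodF-concatMap h f (suc n) =
    trans (ex-prodF-++ (h (f 0)) _) (cong (λ z → ex (prodF (h (f 0))) ℤ.+ z) (ex-prodF-concatMap h (f ∘ suc) n))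

  occ-map : ∀ (g : ℕ → ℕ × ℕ) f n → ℤ.+ occ x y (map g (applyUpTo f n)) ≡ ∑ n (λ i → uncurry δ (g (f i)))
  occ-map g f zero = refl
  occ-map g f (suc n) = cong (λ z → uncurry δ (g (f 0)) ℤ.+ z) (occ-map g (f ∘ suc) n)

  -- f(n , l) is the product of the hook factors with arms 0 … n-1 and leg l.
  ex-fF : ∀ n l → ex (fF n l) ≡ ∑ n (λ a → w a l)
  ex-fF n l = trans (cong₂ ℤ._-_ (occ-map (λ i → (i , suc l)) (λ i → i) n) (occ-map (λ i → (suc i , l)) (λ i → i) n))
                    (sym (∑-- n (λ a → δ a (suc l)) (λ a → δ (suc a) l)))

-- 7. Partitions, seen as antitone sequences D : ℕ → ℕ of row lengths that
--    vanish from row Nr on.  For a column c+1 meeting row r, the rows of D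
--    crossing that column form an interval [0, D′(c+1)); the leg of the box
--    (r , c+1) is D′(c+1) - 1 - r.

module Partitions where

  open FiniteSums
  open Indicators

  count : ℕ → (ℕ → Bool) → ℕ
  count zero g = 0
  count (suc n) g = (if g 0 then 1 else 0) + count n (g ∘ suc)

  count-cong : ∀ n {g h : ℕ → Bool} → (∀ t → t < n → g t ≡ h t) → count n g ≡ count n h
  count-cong zero e = refl
  count-cong (suc n) e = cong₂ (λ a b → (if a then 1 else 0) + b) (e 0 (s≤s z≤n)) (count-cong n (λ t t<n → e (suc t) (s≤s t<n)))

  count-initial : ∀ n k → k ≤ n → count n (λ t → t <ᵇ k) ≡ k
  count-initial n zero _ = count-none n
    where
    count-none : ∀ n → count n (λ t → t <ᵇ 0) ≡ 0
    count-none zero = refl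
    count-none (suc n) = count-none n
  count-initial (suc n) (suc k) (s≤s k≤n) = cong suc (count-initial n k k≤n)

  conj-count : ∀ Nr M (D : ℕ → ℕ) c → conj Nr M D c ≡ count Nr (λ t → c ≤ᵇ D t)
  conj-count Nr M D c = go Nr (λ t → t)
    where
    go : ∀ n f → foldr (λ r acc → (if c ≤ᵇ D r then 1 else 0) + acc) 0 (applyUpTo f n)
               ≡ count n (λ t → c ≤ᵇ D (f t))
    go zero f = refl
    go (suc n) f = cong (_ +_) (go n (f ∘ suc))

  nonzero-row : ∀ Nr (D : ℕ → ℕ) → (∀ t → Nr ≤ t → D t ≡ 0) → ∀ {c t} → c < D t → t < Nr
  nonzero-row Nr D D-vanish {c} {t} c<Dt =
    ℕP.≰⇒> (λ Nr≤t → ℕP.<⇒≱ c<Dt (subst (_≤ c) (sym (D-vanish t Nr≤t)) z≤n))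

  module Antitone (D : ℕ → ℕ) (D-step : ∀ t → D (suc t) ≤ D t) where

    antitone : ∀ {s t} → s ≤ t → D t ≤ D s
    antitone {s} {t} s≤t = subst (λ u → D u ≤ D s) (ℕP.m+[n∸m]≡n s≤t) (go s (t ∸ s))
      where
      go : ∀ s d → D (s + d) ≤ D s
      go s zero rewrite ℕP.+-identityʳ s = ℕP.≤-refl
      go s (suc d) rewrite ℕP.+-suc s d = ℕP.≤-trans (D-step (s + d)) (go s d)

    crossing : ∀ c r d → c < D r → D (r + d) ≤ c →
               Σ[ m₀ ∈ ℕ ] (m₀ < d × c < D (r + m₀) × D (r + suc m₀) ≤ c)
    crossing c r zero c<Dr Dr≤c rewrite ℕP.+-identityʳ r = ⊥-elim (ℕP.<⇒≱ c<Dr Dr≤c)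
    crossing c r (suc d) c<Dr _ with D (r + d) ℕ.≤? c
    ... | yes Dr+d≤c with crossing c r d c<Dr Dr+d≤c
    ...   | m₀ , m₀<d , above , below = m₀ , ℕP.m<n⇒m<1+n m₀<d , above , below
    crossing c r (suc d) c<Dr Dr+sd≤c | no Dr+d≰c = d , ℕP.≤-refl , ℕP.≰⇒> Dr+d≰c , Dr+sd≤c

    crossing-unique : ∀ c r i j → c < D (r + i) → D (r + suc i) ≤ c → c < D (r + j) → D (r + suc j) ≤ c → i ≡ j
    crossing-unique c r i j ai bi aj bj with ℕP.<-cmp i j
    ... | tri≈ _ i≡j _ = i≡j
    ... | tri< i<j _ _ = ⊥-elim (ℕP.<⇒≱ aj (ℕP.≤-trans (antitone (ℕP.+-monoʳ-≤ r i<j)) bi))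
    ... | tri> _ _ j<i = ⊥-elim (ℕP.<⇒≱ ai (ℕP.≤-trans (antitone (ℕP.+-monoʳ-≤ r j<i)) bj))

  module Shape (Nr M : ℕ) (D : ℕ → ℕ) (D-step : ∀ t → D (suc t) ≤ D t) (D-vanish : ∀ t → Nr ≤ t → D t ≡ 0) where

    open Antitone D D-step

    column-length : ∀ c t → c < D t → D (suc t) ≤ c → conj Nr M D (suc c) ≡ suc t
    column-length c t above below =
      trans (conj-count Nr M D (suc c))
        (trans (count-cong Nr crosses) (count-initial Nr (suc t) (nonzero-row Nr D D-vanish above)))
      where
      crosses : ∀ s → s < Nr → (suc c ≤ᵇ D s) ≡ (s <ᵇ suc t)
      crosses s _ with s ℕ.≤? t
      ... | yes s≤t = trans (<ᵇ-true (ℕP.<-≤-trans above (antitone s≤t))) (sym (<ᵇ-true (s≤s s≤t)))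
      ... | no s≰t = trans (<ᵇ-false (ℕP.≤-trans (antitone (ℕP.≰⇒> s≰t)) below)) (sym (<ᵇ-false (ℕP.≰⇒> s≰t)))

    leg : ℕ → ℕ → ℕ
    leg r c = conj Nr M D (suc c) ∸ suc r

    -- Along the diagonal tail  lam m = D (r + m),  the indicator of
    -- lam (m+1) ≤ c < lam m  singles out m = leg r c, provided c < D r; so the
    -- sum only sees g at that point, where it agrees with h.
    ∑-crossing : ∀ r c (lam : ℕ → ℕ) → (∀ m → lam m ≡ D (r + m)) → (g h : ℕ → ℤ) →
      (∀ m → c < lam m → lam (suc m) ≤ c → g m ≡ h m) →
      ∑ Nr (λ m → ind (lam (suc m) ≤ᵇ c) ℤ.* ind (c <ᵇ lam m) ℤ.* g m) ≡ ind (c <ᵇ D r) ℤ.* h (leg r c)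
    ∑-crossing r c lam lam≡D g h g≡h with c <ᵇ D r in c<ᵇDr
    ... | false = ∑-zero Nr none
      where
      none : ∀ m → m < Nr → ind (lam (suc m) ≤ᵇ c) ℤ.* ind (c <ᵇ lam m) ℤ.* g m ≡ 0ℤ
      none m _ rewrite <ᵇ-false {c} {lam m} (subst (_≤ c) (sym (lam≡D m)) (ℕP.≤-trans (antitone (ℕP.m≤m+n r m)) (<ᵇ-false-sound c<ᵇDr)))
        = trans (cong (ℤ._* g m) (ℤP.*-zeroʳ (ind (lam (suc m) ≤ᵇ c)))) (ℤP.*-zeroˡ (g m))
    ... | true = begin
        ∑ Nr summand               ≡⟨ ∑-single Nr m₀ summand m₀<Nr others ⟩
        summand m₀                 ≡⟨ at-m₀ ⟩
        g m₀                       ≡⟨ g≡h m₀ above′ below′ ⟩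
        h m₀                       ≡⟨ cong h (sym leg≡m₀) ⟩
        h (leg r c)                ≡⟨ sym (ℤP.*-identityˡ (h (leg r c))) ⟩
        1ℤ ℤ.* h (leg r c)         ∎
      where
      open ≡-Reasoning
      summand : ℕ → ℤ
      summand m = ind (lam (suc m) ≤ᵇ c) ℤ.* ind (c <ᵇ lam m) ℤ.* g m
      Dr+Nr≤c : D (r + Nr) ≤ c
      Dr+Nr≤c = subst (_≤ c) (sym (D-vanish (r + Nr) (ℕP.m≤n+m Nr r))) z≤n
      found = crossing c r Nr (<ᵇ-sound c<ᵇDr) Dr+Nr≤c
      m₀ = proj₁ found
      m₀<Nr = proj₁ (proj₂ found)
      above = proj₁ (proj₂ (proj₂ found))
      below = proj₂ (proj₂ (proj₂ found))
      leg≡m₀ : leg r c ≡ m₀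
      leg≡m₀ = trans (cong (_∸ suc r) (column-length c (r + m₀) above (subst (λ u → D u ≤ c) (ℕP.+-suc r m₀) below)))
                     (ℕP.m+n∸m≡n r m₀)
      above′ : c < lam m₀
      above′ = subst (c <_) (sym (lam≡D m₀)) above
      below′ : lam (suc m₀) ≤ c
      below′ = subst (_≤ c) (sym (lam≡D (suc m₀))) below
      at-m₀ : summand m₀ ≡ g m₀
      at-m₀ rewrite ≤ᵇ-true below′ | <ᵇ-true above′ = ℤP.*-identityˡ (g m₀)
      others : ∀ m → m < Nr → m ≢ m₀ → summand m ≡ 0ℤ
      others m _ m≢m₀ with c <ᵇ lam m in c<lam | lam (suc m) ≤ᵇ c in lam≤c
      ... | false | b = trans (cong (ℤ._* g m) (ℤP.*-zeroʳ (ind b))) (ℤP.*-zeroˡ (g m))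
      ... | true | false = ℤP.*-zeroˡ (g m)
      ... | true | true = ⊥-elim (m≢m₀ (crossing-unique c r m m₀
              (subst (c <_) (lam≡D m) (<ᵇ-sound c<lam)) (subst (_≤ c) (lam≡D (suc m)) (≤ᵇ-sound lam≤c)) above below))

-- 8. Columns meeting a horizontal strip  α/β  (β ⊆ α).  Column c+1 meets α/β
--    iff some row r has  β r ≤ c < α r.  For antitone α, β this can be read
--    off the single row where α, or β, crosses c.

module Strips where

  open Indicators
  open Partitions

  -- column c meets α/β  (this is the test used in the definition of φ)
  meets : ℕ → (ℕ → ℕ) → (ℕ → ℕ) → ℕ → Bool
  meets Nr α β c = or (map (λ r → (β r <ᵇ c) ∧ (c ≤ᵇ α r)) (upTo Nr))

  or-sound : ∀ (h : ℕ → Bool) f n → or (map h (applyUpTo f n)) ≡ true → Σ[ r ∈ ℕ ] (r < n × h (f r) ≡ true)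
  or-sound h f (suc n) e with h (f 0) in h0
  ... | true = 0 , s≤s z≤n , h0
  ... | false with or-sound h (f ∘ suc) n e
  ...   | r , r<n , hr = suc r , s≤s r<n , hr

  or-complete : ∀ (h : ℕ → Bool) f n r → r < n → h (f r) ≡ true → or (map h (applyUpTo f n)) ≡ true
  or-complete h f (suc n) zero _ e rewrite e = refl
  or-complete h f (suc n) (suc r) (s≤s r<n) e with h (f 0)
  ... | true = refl
  ... | false = or-complete h (f ∘ suc) n r r<n e

  ∧-sound : ∀ {a b : Bool} → (a ∧ b) ≡ true → a ≡ true × b ≡ true
  ∧-sound {true} {true} _ = refl , refl

  meets-sound : ∀ Nr α β c → meets Nr α β (suc c) ≡ true → Σ[ r ∈ ℕ ] (r < Nr × β r ≤ c × c < α r)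
  meets-sound Nr α β c e with or-sound _ (λ r → r) Nr e
  ... | r , r<Nr , hr with ∧-sound {β r <ᵇ suc c} hr
  ...   | βr≤c , c<αr = r , r<Nr , ℕP.≤-pred (<ᵇ-sound βr≤c) , <ᵇ-sound c<αr

  meets-complete : ∀ Nr α β c r → r < Nr → β r ≤ c → c < α r → meets Nr α β (suc c) ≡ true
  meets-complete Nr α β c r r<Nr βr≤c c<αr =
    or-complete _ (λ r → r) Nr r r<Nr (cong₂ _∧_ (<ᵇ-true (s≤s βr≤c)) (<ᵇ-true c<αr))

  module _ (Nr : ℕ) (α β : ℕ → ℕ) (α-step : ∀ t → α (suc t) ≤ α t) (β-step : ∀ t → β (suc t) ≤ β t) where

    open Antitone α α-step renaming (antitone to α-antitone)
    open Antitone β β-step renaming (antitone to β-antitone)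

    meets-via-outer : (∀ t → Nr ≤ t → α t ≡ 0) → ∀ s c → c < β s → β (suc s) ≤ c →
                      meets Nr α β (suc c) ≡ (c <ᵇ α (suc s))
    meets-via-outer α-vanish s c above below = ⇔-bool to from
      where
      to : meets Nr α β (suc c) ≡ true → (c <ᵇ α (suc s)) ≡ true
      to e with meets-sound Nr α β c e
      ... | r , _ , βr≤c , c<αr with s ℕ.<? r
      ...   | yes s<r = <ᵇ-true (ℕP.<-≤-trans c<αr (α-antitone s<r))
      ...   | no s≮r = ⊥-elim (ℕP.<⇒≱ above (ℕP.≤-trans (β-antitone (ℕP.≮⇒≥ s≮r)) βr≤c))
      from : (c <ᵇ α (suc s)) ≡ true → meets Nr α β (suc c) ≡ true
      from e = meets-complete Nr α β c (suc s) (nonzero-row Nr α α-vanish (<ᵇ-sound e)) below (<ᵇ-sound e)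

    meets-via-inner : (∀ t → Nr ≤ t → α t ≡ 0) → ∀ s c → c < α s → α (suc s) ≤ c →
                      meets Nr α β (suc c) ≡ (β s ≤ᵇ c)
    meets-via-inner α-vanish s c above below = ⇔-bool to from
      where
      to : meets Nr α β (suc c) ≡ true → (β s ≤ᵇ c) ≡ true
      to e with meets-sound Nr α β c e
      ... | r , _ , βr≤c , c<αr with r ℕ.≤? s
      ...   | yes r≤s = ≤ᵇ-true (ℕP.≤-trans (β-antitone r≤s) βr≤c)
      ...   | no r≰s = ⊥-elim (ℕP.<⇒≱ c<αr (ℕP.≤-trans (α-antitone (ℕP.≰⇒> r≰s)) below))
      from : (β s ≤ᵇ c) ≡ true → meets Nr α β (suc c) ≡ true
      from e = meets-complete Nr α β c s (nonzero-row Nr α α-vanish above) (≤ᵇ-sound e) above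

-- 9. Exponents of the factors of Φ_π, column by column.  For a partition D,
--    ψ D r c is the exponent of b_D(r , c+1) and  column D c  that of the
--    whole column c+1 of b_D.

module PhiExponents (x y Nr M : ℕ) where

  open FiniteSums
  open Indicators
  open BasicExponents x y
  open Strips using (meets; meets-sound)

  ψ : (ℕ → ℕ) → ℕ → ℕ → ℤ
  ψ D r c = ind (c <ᵇ D r) ℤ.* w (D r ∸ suc c) (conj Nr M D (suc c) ∸ suc r)

  column : (ℕ → ℕ) → ℕ → ℤ
  column D c = ∑ Nr (λ r → ψ D r c)

  ψ-empty : ∀ D r c → D r ≡ 0 → ψ D r c ≡ 0ℤ
  ψ-empty D r c Dr≡0 rewrite Dr≡0 = refl

  -- b_D(s) is the hook factor with the arm and leg of s, or 1 outside D.
  ex-bBox : ∀ D r c → ex (bBox Nr M D r (suc c)) ≡ ψ D r c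
  ex-bBox D r c with c <ᵇ D r
  ... | false = refl
  ... | true = single (if is x y arm (suc leg) then 1 else 0) (if is x y (suc arm) leg then 1 else 0)
    where
    open FactorCounting using (is)
    arm = D r ∸ suc c
    leg = conj Nr M D (suc c) ∸ suc r
    single : ∀ a b → ℤ.+ (a + 0) ℤ.- ℤ.+ (b + 0) ≡ 1ℤ ℤ.* (ℤ.+ a ℤ.- ℤ.+ b)
    single a b rewrite ℕP.+-identityʳ a | ℕP.+-identityʳ b = sym (ℤP.*-identityˡ _)

  ex-bPart : ∀ D → ex (bPart Nr M D) ≡ ∑ M (column D)
  ex-bPart D = begin
      ex (bPart Nr M D)
    ≡⟨ ex-prodF-concatMap (λ r → map (λ c → bBox Nr M D r c) (cols Nr M)) (λ r → r) Nr ⟩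
      ∑ Nr (λ r → ex (prodF (map (λ c → bBox Nr M D r c) (map suc (upTo M)))))
    ≡⟨ ∑-cong Nr (λ r → trans (cong (λ l → ex (prodF (map (λ c → bBox Nr M D r c) l))) (map-applyUpTo (λ c → c) suc M))
                               (ex-prodF-map (λ c → bBox Nr M D r c) suc M)) ⟩
      ∑ Nr (λ r → ∑ M (λ c → ex (bBox Nr M D r (suc c))))
    ≡⟨ ∑-cong Nr (λ r → ∑-cong M (ex-bBox D r)) ⟩
      ∑ Nr (λ r → ∑ M (ψ D r))
    ≡⟨ ∑-swap Nr M (ψ D) ⟩
      ∑ M (column D)
    ∎
    where open ≡-Reasoning

  ex-if : ∀ b L → ex (prodF (if b then L else [])) ≡ ind b ℤ.* ex (prodF L)
  ex-if true L = sym (ℤP.*-identityˡ _)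
  ex-if false L = refl

  ex-φ : ∀ α β → ex (φ Nr M α β) ≡ ∑ M (λ c → ind (meets Nr α β (suc c)) ℤ.* (column α c ℤ.- column β c))
  ex-φ α β = begin
      ex (φ Nr M α β)
    ≡⟨ cong (λ l → ex (prodF (concatMap colFactor l))) (map-applyUpTo (λ c → c) suc M) ⟩
      ex (prodF (concatMap colFactor (applyUpTo suc M)))
    ≡⟨ ex-prodF-concatMap colFactor suc M ⟩
      ∑ M (λ c → ex (prodF (colFactor (suc c))))
    ≡⟨ ∑-cong M (λ c → trans (ex-if (meets Nr α β (suc c)) (quotients (suc c))) (cong (ind (meets Nr α β (suc c)) ℤ.*_) (ex-quotients c))) ⟩
      ∑ M (λ c → ind (meets Nr α β (suc c)) ℤ.* (column α c ℤ.- column β c))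
    ∎
    where
    open ≡-Reasoning
    quotients : ℕ → List Frac
    quotients c = map (λ r → bBox Nr M α r c ⊗ invF (bBox Nr M β r c)) (upTo Nr)
    colFactor : ℕ → List Frac
    colFactor c = if meets Nr α β c then quotients c else []
    ex-quotients : ∀ c → ex (prodF (quotients (suc c))) ≡ column α c ℤ.- column β c
    ex-quotients c = begin
        ex (prodF (quotients (suc c)))
      ≡⟨ ex-prodF-map (λ r → bBox Nr M α r (suc c) ⊗ invF (bBox Nr M β r (suc c))) (λ r → r) Nr ⟩
        ∑ Nr (λ r → ex (bBox Nr M α r (suc c) ⊗ invF (bBox Nr M β r (suc c))))
      ≡⟨ ∑-cong Nr (λ r → trans (ex-⊗ (bBox Nr M α r (suc c)) (invF (bBox Nr M β r (suc c))))
                                (cong₂ ℤ._+_ (ex-bBox α r c) (trans (ex-inv (bBox Nr M β r (suc c))) (cong ℤ.-_ (ex-bBox β r c))))) ⟩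
        ∑ Nr (λ r → ψ α r c ℤ.- ψ β r c)
      ≡⟨ ∑-- Nr (λ r → ψ α r c) (λ r → ψ β r c) ⟩
        column α c ℤ.- column β c
      ∎

  and-sound : ∀ (h : ℕ → Bool) f n → and (map h (applyUpTo f n)) ≡ true → ∀ r → r < n → h (f r) ≡ true
  and-sound h f (suc n) e zero _ with h (f 0) | e
  ... | true | _ = refl
  and-sound h f (suc n) e (suc r) (s≤s r<n) with h (f 0) | e
  ... | true | e′ = and-sound h (f ∘ suc) n e′ r r<n

  and-complete : ∀ (h : ℕ → Bool) f n → (∀ r → h (f r) ≡ true) → and (map h (applyUpTo f n)) ≡ true
  and-complete h f zero e = refl
  and-complete h f (suc n) e rewrite e 0 = and-complete h (f ∘ suc) n (e ∘ suc)

  φbr-⊇ : ∀ α β → (∀ r → β r ≤ α r) → φbr Nr M α β ≡ φ Nr M α β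
  φbr-⊇ α β β⊆α rewrite and-complete (λ r → β r ≤ᵇ α r) (λ r → r) Nr (λ r → ≤ᵇ-true (β⊆α r)) = refl

  ex-φ-equal : ∀ α β → (∀ r → r < Nr → α r ≡ β r) → ex (φ Nr M α β) ≡ 0ℤ
  ex-φ-equal α β α≡β = trans (ex-φ α β) (∑-zero M (λ c _ → cong (λ b → ind b ℤ.* (column α c ℤ.- column β c)) (no-column c)))
    where
    no-column : ∀ c → meets Nr α β (suc c) ≡ false
    no-column c with meets Nr α β (suc c) in e
    ... | false = refl
    ... | true with meets-sound Nr α β c e
    ...   | r , r<Nr , βr≤c , c<αr rewrite α≡β r r<Nr = ⊥-elim (ℕP.<⇒≱ c<αr βr≤c)

  -- For α ⊆ β, φ_{[α/β]} has the exponents of φ_{β/α} (if also β ⊆ α, both are 1).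
  ex-φbr-⊆ : ∀ α β → (∀ r → α r ≤ β r) → ex (φbr Nr M α β) ≡ ex (φ Nr M β α)
  ex-φbr-⊆ α β α⊆β with and (map (λ r → β r ≤ᵇ α r) (upTo Nr)) in β⊆α
  ... | false = refl
  ... | true = trans (ex-φ-equal α β α≡β) (sym (ex-φ-equal β α (λ r r<Nr → sym (α≡β r r<Nr))))
    where
    α≡β : ∀ r → r < Nr → α r ≡ β r
    α≡β r r<Nr = ℕP.≤-antisym (α⊆β r) (≤ᵇ-sound (and-sound (λ r → β r ≤ᵇ α r) (λ r → r) Nr β⊆α r r<Nr))

-- 10. The exponent of one box factor F_π(i , j), as a double sum over
--    columns c and diagonal steps m.  Each f(n , m) is a product of hook
--    factors with arms a < n; writing a = λ₁ - 1 - c turns the four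
--    f-factors of step m into the column range λ_{m+1} ≤ c < λ_m, weighted
--    by [μ_m ≤ c] - [c < ν_m].

module BoxExponents (x y : ℕ) where

  open FiniteSums
  open Indicators
  open BasicExponents x y

  arms-as-columns : ∀ l v m → ∑ (l ∸ v) (λ a → w a m) ≡ ∑ l (λ c → ind (v ≤ᵇ c) ℤ.* w (l ∸ suc c) m)
  arms-as-columns zero zero m = refl
  arms-as-columns zero (suc v) m = refl
  arms-as-columns (suc l) zero m =
    trans (∑-last l (λ a → w a m))
      (trans (cong (ℤ._+ w l m) (arms-as-columns l zero m)) (last-to-front (w l m) _))
    where
    last-to-front : ∀ a b → b ℤ.+ a ≡ 1ℤ ℤ.* a ℤ.+ b
    last-to-front = solve-∀
  arms-as-columns (suc l) (suc v) m =
    trans (arms-as-columns l v m)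
      (trans (∑-cong l (λ c → cong (λ b → ind b ℤ.* w (l ∸ suc c) m) (≤ᵇ-suc v c))) (sym (ℤP.+-identityˡ _)))

  -- For μ, ν interlacing λ_{m+1} ≤ μ, ν ≤ λ_m, the four indicators combine
  -- into the strip  λ_{m+1} ≤ c < λ_m.
  strip-indicator : ∀ (b₀ bμ bν b₁ : Bool) → (b₀ ≡ true → bμ ≡ true) → (bμ ≡ true → b₁ ≡ true)
                  → (b₀ ≡ true → bν ≡ true) → (bν ≡ true → b₁ ≡ true)
                  → (ind bμ ℤ.+ ind bν) ℤ.- (ind b₀ ℤ.+ ind b₁) ≡ ind b₁ ℤ.* ind (not b₀) ℤ.* (ind bμ ℤ.- ind (not bν))
  strip-indicator true bμ bν b₁ h₁ h₂ h₃ _ rewrite h₁ refl | h₃ refl | h₂ refl = refl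
  strip-indicator false bμ bν true _ _ _ _ rewrite ind-not bν = inside (ind bμ) (ind bν)
    where
    inside : ∀ a b → (a ℤ.+ b) ℤ.- (0ℤ ℤ.+ 1ℤ) ≡ 1ℤ ℤ.* 1ℤ ℤ.* (a ℤ.- (1ℤ ℤ.- b))
    inside = solve-∀
  strip-indicator false true _ false _ h₂ _ _ = false≢true (h₂ refl)
  strip-indicator false false true false _ _ _ h₄ = false≢true (h₄ refl)
  strip-indicator false false false false _ _ _ _ = refl

  S : ℕ → ℕ → ℤ
  S n m = ∑ n (λ a → w a m)

  strip-term : (lam mu nu : ℕ → ℕ) → ℕ → ℕ → ℤ
  strip-term lam mu nu c m =
    ind (lam (suc m) ≤ᵇ c) ℤ.* ind (c <ᵇ lam m) ℤ.* (w (lam 0 ∸ suc c) m ℤ.* (ind (mu m ≤ᵇ c) ℤ.- ind (c <ᵇ nu m)))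

  box-exchange : ∀ Nr (lam mu nu : ℕ → ℕ)
    → (∀ m → lam (suc m) ≤ mu m) → (∀ m → mu m ≤ lam m)
    → (∀ m → lam (suc m) ≤ nu m) → (∀ m → nu m ≤ lam m)
    → ∑ Nr (λ m → (S (lam 0 ∸ mu m) m ℤ.+ S (lam 0 ∸ nu m) m) ℤ.- (S (lam 0 ∸ lam m) m ℤ.+ S (lam 0 ∸ lam (suc m)) m))
      ≡ ∑ (lam 0) (λ c → ∑ Nr (strip-term lam mu nu c))
  box-exchange Nr lam mu nu lam≤mu mu≤lam lam≤nu nu≤lam =
    trans (∑-cong Nr step) (∑-swap Nr (lam 0) (λ m c → strip-term lam mu nu c m))
    where
    l₁ = lam 0
    term : ℕ → ℕ → ℕ → ℤ
    term v m c = ind (v ≤ᵇ c) ℤ.* w (l₁ ∸ suc c) m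
    step : ∀ m → (S (l₁ ∸ mu m) m ℤ.+ S (l₁ ∸ nu m) m) ℤ.- (S (l₁ ∸ lam m) m ℤ.+ S (l₁ ∸ lam (suc m)) m)
               ≡ ∑ l₁ (λ c → strip-term lam mu nu c m)
    step m = begin
        (S (l₁ ∸ mu m) m ℤ.+ S (l₁ ∸ nu m) m) ℤ.- (S (l₁ ∸ lam m) m ℤ.+ S (l₁ ∸ lam (suc m)) m)
      ≡⟨ cong₂ ℤ._-_ (cong₂ ℤ._+_ (arms-as-columns l₁ (mu m) m) (arms-as-columns l₁ (nu m) m))
                     (cong₂ ℤ._+_ (arms-as-columns l₁ (lam m) m) (arms-as-columns l₁ (lam (suc m)) m)) ⟩
        (∑ l₁ (term (mu m) m) ℤ.+ ∑ l₁ (term (nu m) m)) ℤ.- (∑ l₁ (term (lam m) m) ℤ.+ ∑ l₁ (term (lam (suc m)) m))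
      ≡⟨ sym (cong₂ ℤ._-_ (∑-+ l₁ _ _) (∑-+ l₁ _ _)) ⟩
        ∑ l₁ (λ c → term (mu m) m c ℤ.+ term (nu m) m c) ℤ.- ∑ l₁ (λ c → term (lam m) m c ℤ.+ term (lam (suc m)) m c)
      ≡⟨ sym (∑-- l₁ _ _) ⟩
        ∑ l₁ (λ c → (term (mu m) m c ℤ.+ term (nu m) m c) ℤ.- (term (lam m) m c ℤ.+ term (lam (suc m)) m c))
      ≡⟨ ∑-cong l₁ at-column ⟩
        ∑ l₁ (λ c → strip-term lam mu nu c m)
      ∎
      where
      open ≡-Reasoning
      at-column : ∀ c → (term (mu m) m c ℤ.+ term (nu m) m c) ℤ.- (term (lam m) m c ℤ.+ term (lam (suc m)) m c)
                      ≡ strip-term lam mu nu c m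
      at-column c rewrite <ᵇ-not-≤ᵇ c (lam m) | <ᵇ-not-≤ᵇ c (nu m) =
        trans (factor (ind (mu m ≤ᵇ c)) (ind (nu m ≤ᵇ c)) (ind (lam m ≤ᵇ c)) (ind (lam (suc m) ≤ᵇ c)) W)
          (trans (cong (W ℤ.*_) (strip-indicator (lam m ≤ᵇ c) (mu m ≤ᵇ c) (nu m ≤ᵇ c) (lam (suc m) ≤ᵇ c)
                   (≤ᵇ-antitone c (mu≤lam m)) (≤ᵇ-antitone c (lam≤mu m)) (≤ᵇ-antitone c (nu≤lam m)) (≤ᵇ-antitone c (lam≤nu m))))
                 (reorder (ind (lam (suc m) ≤ᵇ c)) (ind (not (lam m ≤ᵇ c))) (ind (mu m ≤ᵇ c)) (ind (not (nu m ≤ᵇ c))) W))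
        where
        W = w (l₁ ∸ suc c) m
        reorder : ∀ e n a n′ W → W ℤ.* (e ℤ.* n ℤ.* (a ℤ.- n′)) ≡ e ℤ.* n ℤ.* (W ℤ.* (a ℤ.- n′))
        reorder = solve-∀
        factor : ∀ a b d e W → (a ℤ.* W ℤ.+ b ℤ.* W) ℤ.- (d ℤ.* W ℤ.+ e ℤ.* W) ≡ W ℤ.* ((a ℤ.+ b) ℤ.- (d ℤ.+ e))
        factor = solve-∀

-- 11. The diagonals of a plane partition.  U k = λ^k (k ≥ 0) and
--     L k = λ^{-(k+1)}; all are partitions with at most N rows and parts ≤ M.

module Diagonals (P : PlanePartition) where

  Nr = N P
  M = π P 0 0

  U : ℕ → ℕ → ℕ
  U k t = π P t (k + t)

  L : ℕ → ℕ → ℕ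
  L k t = π P (suc k + t) t

  U-step : ∀ k t → U k (suc t) ≤ U k t
  U-step k t = ℕP.≤-trans (colDec P t (k + suc t))
    (subst (λ j → π P t j ≤ π P t (k + t)) (sym (ℕP.+-suc k t)) (rowDec P t (k + t)))

  L-step : ∀ k t → L k (suc t) ≤ L k t
  L-step k t = ℕP.≤-trans
    (subst (λ i → π P i (suc t) ≤ π P (suc k + t) (suc t)) (sym (cong suc (ℕP.+-suc k t))) (colDec P (suc k + t) (suc t)))
    (rowDec P (suc k + t) t)

  U-vanish : ∀ k t → Nr ≤ t → U k t ≡ 0
  U-vanish k t Nr≤t = finite P t (k + t) (inj₁ Nr≤t)

  L-vanish : ∀ k t → Nr ≤ t → L k t ≡ 0
  L-vanish k t Nr≤t = finite P (suc k + t) t (inj₂ Nr≤t)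

  U-far : ∀ k t → Nr ≤ k → U k t ≡ 0
  U-far k t Nr≤k = finite P t (k + t) (inj₂ (ℕP.≤-trans Nr≤k (ℕP.m≤m+n k t)))

  L-far : ∀ k t → Nr ≤ k → L k t ≡ 0
  L-far k t Nr≤k = finite P (suc k + t) t (inj₁ (ℕP.≤-trans Nr≤k (ℕP.≤-trans (ℕP.m≤m+n k t) (ℕP.n≤1+n _))))

  bounded : ∀ i j → π P i j ≤ M
  bounded i j = ℕP.≤-trans (along-row i j) (along-column i)
    where
    along-row : ∀ i j → π P i j ≤ π P i 0
    along-row i zero = ℕP.≤-refl
    along-row i (suc j) = ℕP.≤-trans (rowDec P i j) (along-row i j)
    along-column : ∀ i → π P i 0 ≤ M
    along-column zero = ℕP.≤-refl
    along-column (suc i) = ℕP.≤-trans (colDec P i 0) (along-column i)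

module FExponents (P : PlanePartition) (x y : ℕ) where

  open FiniteSums
  open Indicators
  open BasicExponents x y
  open BoxExponents x y
  open Diagonals P
  open PhiExponents x y Nr M using (ψ; ψ-empty)
  open Partitions using (module Shape)

  lam mu nu : ℕ → ℕ → ℕ → ℕ
  lam i j m = π P (i + m) (j + m)
  mu i j m = π P (suc i + m) (j + m)
  nu i j m = π P (i + m) (suc j + m)

  ex-Fbox : ∀ i j → ex (Fbox P i j) ≡
    ∑ Nr (λ m → (S (lam i j 0 ∸ mu i j m) m ℤ.+ S (lam i j 0 ∸ nu i j m) m)
                ℤ.- (S (lam i j 0 ∸ lam i j m) m ℤ.+ S (lam i j 0 ∸ lam i j (suc m)) m))
  ex-Fbox i j = trans (ex-prodF-map _ (λ m → m) Nr) (∑-cong Nr step)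
    where
    l₁ = lam i j 0
    step : ∀ m → ex ((fF (l₁ ∸ mu i j m) m ⊗ fF (l₁ ∸ nu i j m) m) ⊗ invF (fF (l₁ ∸ lam i j m) m ⊗ fF (l₁ ∸ lam i j (suc m)) m))
               ≡ (S (l₁ ∸ mu i j m) m ℤ.+ S (l₁ ∸ nu i j m) m) ℤ.- (S (l₁ ∸ lam i j m) m ℤ.+ S (l₁ ∸ lam i j (suc m)) m)
    step m = trans (ex-⊗ (fa ⊗ fb) (invF (fc ⊗ fd)))
      (cong₂ ℤ._+_ (trans (ex-⊗ fa fb) (cong₂ ℤ._+_ (ex-fF (l₁ ∸ mu i j m) m) (ex-fF (l₁ ∸ nu i j m) m)))
                   (trans (ex-inv (fc ⊗ fd))
                          (cong ℤ.-_ (trans (ex-⊗ fc fd) (cong₂ ℤ._+_ (ex-fF (l₁ ∸ lam i j m) m) (ex-fF (l₁ ∸ lam i j (suc m)) m))))))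
      where
      fa = fF (l₁ ∸ mu i j m) m
      fb = fF (l₁ ∸ nu i j m) m
      fc = fF (l₁ ∸ lam i j m) m
      fd = fF (l₁ ∸ lam i j (suc m)) m

  -- If the box (i , j) sits in row r of the diagonal partition D, and on the
  -- strip where D crosses c the sign [μ_m ≤ c] - [c < ν_m] equals K c, then
  -- F_π(i , j) contributes K c times the exponent of b_D(r , c+1).
  box-on-diagonal : ∀ i j (D : ℕ → ℕ) → (∀ t → D (suc t) ≤ D t) → (∀ t → Nr ≤ t → D t ≡ 0) →
    ∀ r → (∀ m → lam i j m ≡ D (r + m)) → (K : ℕ → ℤ) →
    (∀ c m → c < D (r + m) → D (suc (r + m)) ≤ c → ind (mu i j m ≤ᵇ c) ℤ.- ind (c <ᵇ nu i j m) ≡ K c) →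
    ex (Fbox P i j) ≡ ∑ M (λ c → K c ℤ.* ψ D r c)
  box-on-diagonal i j D D-step D-vanish r on-D K sign = begin
      ex (Fbox P i j)
    ≡⟨ ex-Fbox i j ⟩
      ∑ Nr (λ m → (S (l₁ ∸ mu i j m) m ℤ.+ S (l₁ ∸ nu i j m) m) ℤ.- (S (l₁ ∸ lam i j m) m ℤ.+ S (l₁ ∸ lam i j (suc m)) m))
    ≡⟨ box-exchange Nr (lam i j) (mu i j) (nu i j) λ≤μ μ≤λ λ≤ν ν≤λ ⟩
      ∑ l₁ (λ c → ∑ Nr (strip-term (lam i j) (mu i j) (nu i j) c))
    ≡⟨ ∑-cong l₁ column-c ⟩
      ∑ l₁ (λ c → K c ℤ.* ψ D r c)
    ≡⟨ sym (∑-extend l₁ M _ (bounded (i + 0) (j + 0)) outside) ⟩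
      ∑ M (λ c → K c ℤ.* ψ D r c)
    ∎
    where
    open ≡-Reasoning
    open Shape Nr M D D-step D-vanish using (∑-crossing)
    l₁ = lam i j 0
    l₁≡Dr : l₁ ≡ D r
    l₁≡Dr = trans (on-D 0) (cong D (ℕP.+-identityʳ r))
    λ≤μ : ∀ m → lam i j (suc m) ≤ mu i j m
    λ≤μ m rewrite ℕP.+-suc i m | ℕP.+-suc j m = rowDec P (suc (i + m)) (j + m)
    μ≤λ : ∀ m → mu i j m ≤ lam i j m
    μ≤λ m = colDec P (i + m) (j + m)
    λ≤ν : ∀ m → lam i j (suc m) ≤ nu i j m
    λ≤ν m rewrite ℕP.+-suc i m | ℕP.+-suc j m = colDec P (i + m) (suc (j + m))
    ν≤λ : ∀ m → nu i j m ≤ lam i j m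
    ν≤λ m = rowDec P (i + m) (j + m)
    column-c : ∀ c → ∑ Nr (strip-term (lam i j) (mu i j) (nu i j) c) ≡ K c ℤ.* ψ D r c
    column-c c = begin
        ∑ Nr (strip-term (lam i j) (mu i j) (nu i j) c)
      ≡⟨ ∑-crossing r c (lam i j) on-D _ (λ m → w (D r ∸ suc c) m ℤ.* K c) same-sign ⟩
        ind (c <ᵇ D r) ℤ.* (w (D r ∸ suc c) leg ℤ.* K c)
      ≡⟨ reorder (ind (c <ᵇ D r)) (w (D r ∸ suc c) leg) (K c) ⟩
        K c ℤ.* ψ D r c
      ∎
      where
      leg = conj Nr M D (suc c) ∸ suc r
      reorder : ∀ a b k → a ℤ.* (b ℤ.* k) ≡ k ℤ.* (a ℤ.* b)
      reorder = solve-∀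
      same-sign : ∀ m → c < lam i j m → lam i j (suc m) ≤ c →
        w (l₁ ∸ suc c) m ℤ.* (ind (mu i j m ≤ᵇ c) ℤ.- ind (c <ᵇ nu i j m)) ≡ w (D r ∸ suc c) m ℤ.* K c
      same-sign m above below = cong₂ (λ l k → w (l ∸ suc c) m ℤ.* k) l₁≡Dr
        (sign c m (subst (c <_) (on-D m) above) (subst (_≤ c) (trans (on-D (suc m)) (cong D (ℕP.+-suc r m))) below))
    outside : ∀ c → l₁ ≤ c → c < M → K c ℤ.* ψ D r c ≡ 0ℤ
    outside c l₁≤c _ rewrite <ᵇ-false {c} {D r} (subst (_≤ c) l₁≡Dr l₁≤c) = ℤP.*-zeroʳ (K c)

  central : ℕ → Bool
  central c = Strips.meets Nr (U 0) (L 0) (suc c)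

  upper lower : ℕ → ℕ → Bool
  upper k c = Strips.meets Nr (U k) (U (suc k)) (suc c)
  lower k c = Strips.meets Nr (L k) (L (suc k)) (suc c)

  signU signL : ℕ → ℕ → ℤ
  signU zero c = ind (central c) ℤ.- (1ℤ ℤ.- ind (upper 0 c))
  signU (suc k) c = ind (upper (suc k) c) ℤ.- ind (upper k c)
  signL zero c = ind (lower 0 c) ℤ.- ind (central c)
  signL (suc k) c = ind (lower (suc k) c) ℤ.- ind (lower k c)

  sign-swap : ∀ a b c → ind (a ≤ᵇ c) ℤ.- ind (c <ᵇ b) ≡ ind (b ≤ᵇ c) ℤ.- ind (c <ᵇ a)
  sign-swap a b c rewrite ind-< c b | ind-< c a = swap (ind (a ≤ᵇ c)) (ind (b ≤ᵇ c))
    where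
    swap : ∀ p q → p ℤ.- (1ℤ ℤ.- q) ≡ q ℤ.- (1ℤ ℤ.- p)
    swap = solve-∀

  box-upper : ∀ k r → ex (Fbox P r (k + r)) ≡ ∑ M (λ c → signU k c ℤ.* ψ (U k) r c)
  box-upper k r = box-on-diagonal r (k + r) (U k) (U-step k) (U-vanish k) r
                    (λ m → cong (π P (r + m)) (ℕP.+-assoc k r m)) (signU k) (sign k)
    where
    open Strips using (meets-via-inner; meets-via-outer)
    sign : ∀ k c m → c < U k (r + m) → U k (suc (r + m)) ≤ c →
           ind (mu r (k + r) m ≤ᵇ c) ℤ.- ind (c <ᵇ nu r (k + r) m) ≡ signU k c
    sign zero c m above below =
      trans (cong (λ z → ind (L 0 (r + m) ≤ᵇ c) ℤ.- z) (ind-< c (U 1 (r + m))))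
        (cong₂ (λ p q → ind p ℤ.- (1ℤ ℤ.- ind q))
          (sym (meets-via-inner Nr (U 0) (L 0) (U-step 0) (L-step 0) (U-vanish 0) (r + m) c above below))
          (sym (meets-via-inner Nr (U 0) (U 1) (U-step 0) (U-step 1) (U-vanish 0) (r + m) c above below)))
    sign (suc k) c m above below = begin
        ind (mu r (suc k + r) m ≤ᵇ c) ℤ.- ind (c <ᵇ nu r (suc k + r) m)
      ≡⟨ cong₂ (λ a b → ind (a ≤ᵇ c) ℤ.- ind (c <ᵇ b)) (cong (π P (suc (r + m))) next-row) (cong (π P (r + m)) two-right) ⟩
        ind (U k (suc (r + m)) ≤ᵇ c) ℤ.- ind (c <ᵇ U (suc (suc k)) (r + m))
      ≡⟨ sign-swap (U k (suc (r + m))) (U (suc (suc k)) (r + m)) c ⟩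
        ind (U (suc (suc k)) (r + m) ≤ᵇ c) ℤ.- ind (c <ᵇ U k (suc (r + m)))
      ≡⟨ cong₂ (λ p q → ind p ℤ.- ind q) 
           (sym (meets-via-inner Nr (U (suc k)) (U (suc (suc k))) (U-step (suc k)) (U-step (suc (suc k))) (U-vanish (suc k)) (r + m) c above below))
           (sym (meets-via-outer Nr (U k) (U (suc k)) (U-step k) (U-step (suc k)) (U-vanish k) (r + m) c above below)) ⟩
        signU (suc k) c
      ∎
      where
      open ≡-Reasoning
      next-row : suc k + r + m ≡ k + suc (r + m)
      next-row = trans (cong suc (ℕP.+-assoc k r m)) (sym (ℕP.+-suc k (r + m)))
      two-right : suc (suc k + r) + m ≡ suc (suc k) + (r + m)
      two-right = cong (λ z → suc (suc z)) (ℕP.+-assoc k r m)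

  box-lower : ∀ k r → ex (Fbox P (suc k + r) r) ≡ ∑ M (λ c → signL k c ℤ.* ψ (L k) r c)
  box-lower k r = box-on-diagonal (suc k + r) r (L k) (L-step k) (L-vanish k) r
                    (λ m → cong (λ i → π P (suc i) (r + m)) (ℕP.+-assoc k r m)) (signL k) (sign k)
    where
    open Strips using (meets-via-inner; meets-via-outer)
    sign : ∀ k c m → c < L k (r + m) → L k (suc (r + m)) ≤ c →
           ind (mu (suc k + r) r m ≤ᵇ c) ℤ.- ind (c <ᵇ nu (suc k + r) r m) ≡ signL k c
    sign zero c m above below = cong₂ (λ p q → ind p ℤ.- ind q)
      (sym (meets-via-inner Nr (L 0) (L 1) (L-step 0) (L-step 1) (L-vanish 0) (r + m) c above below))
      (sym (meets-via-outer Nr (U 0) (L 0) (U-step 0) (L-step 0) (U-vanish 0) (r + m) c above below))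
    sign (suc k) c m above below = begin
        ind (mu (suc (suc k) + r) r m ≤ᵇ c) ℤ.- ind (c <ᵇ nu (suc (suc k) + r) r m)
      ≡⟨ cong₂ (λ a b → ind (a ≤ᵇ c) ℤ.- ind (c <ᵇ b))
               (cong (λ i → π P (suc (suc (suc i))) (r + m)) (ℕP.+-assoc k r m))
               (cong (λ i → π P (suc i) (suc (r + m))) next-diagonal) ⟩
        ind (L (suc (suc k)) (r + m) ≤ᵇ c) ℤ.- ind (c <ᵇ L k (suc (r + m)))
      ≡⟨ cong₂ (λ p q → ind p ℤ.- ind q)
           (sym (meets-via-inner Nr (L (suc k)) (L (suc (suc k))) (L-step (suc k)) (L-step (suc (suc k))) (L-vanish (suc k)) (r + m) c above below))
           (sym (meets-via-outer Nr (L k) (L (suc k)) (L-step k) (L-step (suc k)) (L-vanish k) (r + m) c above below)) ⟩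
        signL (suc k) c
      ∎
      where
      open ≡-Reasoning
      next-diagonal : suc k + r + m ≡ k + suc (r + m)
      next-diagonal = trans (cong suc (ℕP.+-assoc k r m)) (sym (ℕP.+-suc k (r + m)))

-- 13. Both sides, column by column.  With  a k c, b k c  the exponents of
--     column c+1 of b_{λ^k} and b_{λ^{-(k+1)}}:
--       F_π : Σ_c [ Σ_k signU k c · a k c + Σ_k signL k c · b k c ],
--       Φ_π : Σ_c [ -a 0 c + central·(a 0 c - b 0 c)
--                   + Σ_k upper k c·(a k c - a (k+1) c) + Σ_k lower k c·(b k c - b (k+1) c) ],
--     and the two column terms agree by Abel summation.

module Assembly (P : PlanePartition) (x y : ℕ) where

  open import Data.Integer using (+_)

  open FiniteSums
  open Rearrangements
  open Indicators
  open BasicExponents x y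
  open Diagonals P
  open PhiExponents x y Nr M
  open FExponents P x y

  a b : ℕ → ℕ → ℤ
  a k c = column (U k) c
  b k c = column (L k) c

  boxF : ℕ → ℕ → ℤ
  boxF i j = ex (ifPos (π P i j) (Fbox P i j))

  ex-Fπ : ex (Fπ P) ≡ ∑ Nr (λ i → ∑ Nr (boxF i))
  ex-Fπ = trans (ex-prodF-concatMap (λ i → map (λ j → ifPos (π P i j) (Fbox P i j)) (upTo Nr)) (λ i → i) Nr)
                (∑-cong Nr (λ i → ex-prodF-map (λ j → ifPos (π P i j) (Fbox P i j)) (λ j → j) Nr))

  boxF-formula : ∀ i j (D : ℕ → ℕ) r (sign : ℕ → ℤ) → D r ≡ π P i j →
    ex (Fbox P i j) ≡ ∑ M (λ c → sign c ℤ.* ψ D r c) → boxF i j ≡ ∑ M (λ c → sign c ℤ.* ψ D r c)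
  boxF-formula i j D r sign Dr≡π formula with π P i j
  ... | suc _ = formula
  ... | zero = sym (∑-zero M (λ c _ → trans (cong (sign c ℤ.*_) (ψ-empty D r c Dr≡π)) (ℤP.*-zeroʳ (sign c))))

  by-columns : ∀ (sign : ℕ → ℕ → ℤ) (D : ℕ → ℕ → ℕ) →
    ∑ Nr (λ k → ∑ Nr (λ r → ∑ M (λ c → sign k c ℤ.* ψ (D k) r c)))
    ≡ ∑ M (λ c → ∑ Nr (λ k → sign k c ℤ.* column (D k) c))
  by-columns sign D =
    trans (∑-cong Nr (λ k → trans (∑-swap Nr M (λ r c → sign k c ℤ.* ψ (D k) r c))
                                  (∑-cong M (λ c → ∑-* Nr (sign k c) (λ r → ψ (D k) r c)))))
          (∑-swap Nr M (λ k c → sign k c ℤ.* column (D k) c))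

  F-column : ℕ → ℤ
  F-column c = ∑ Nr (λ k → signU k c ℤ.* a k c) ℤ.+ ∑ Nr (λ k → signL k c ℤ.* b k c)

  F-side : ex (Fπ P) ≡ ∑ M F-column
  F-side = begin
      ex (Fπ P)
    ≡⟨ ex-Fπ ⟩
      ∑ Nr (λ i → ∑ Nr (boxF i))
    ≡⟨ ∑-diagonals Nr boxF outside ⟩
      ∑ Nr (λ k → ∑ Nr (λ r → boxF r (k + r))) ℤ.+ ∑ Nr (λ k → ∑ Nr (λ r → boxF (suc k + r) r))
    ≡⟨ cong₂ ℤ._+_ (∑-cong Nr (λ k → ∑-cong Nr (λ r → boxF-formula r (k + r) (U k) r (signU k) refl (box-upper k r))))
                   (∑-cong Nr (λ k → ∑-cong Nr (λ r → boxF-formula (suc k + r) r (L k) r (signL k) refl (box-lower k r)))) ⟩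
      ∑ Nr (λ k → ∑ Nr (λ r → ∑ M (λ c → signU k c ℤ.* ψ (U k) r c)))
        ℤ.+ ∑ Nr (λ k → ∑ Nr (λ r → ∑ M (λ c → signL k c ℤ.* ψ (L k) r c)))
    ≡⟨ cong₂ ℤ._+_ (by-columns signU U) (by-columns signL L) ⟩
      ∑ M (λ c → ∑ Nr (λ k → signU k c ℤ.* a k c)) ℤ.+ ∑ M (λ c → ∑ Nr (λ k → signL k c ℤ.* b k c))
    ≡⟨ sym (∑-+ M _ _) ⟩
      ∑ M F-column
    ∎
    where
    open ≡-Reasoning
    outside : ∀ i j → Nr ≤ i ⊎ Nr ≤ j → boxF i j ≡ 0ℤ
    outside i j far rewrite finite P i j far = refl

  φterm : ℤ → Frac
  φterm n = φbr Nr M (diag P (n ℤ.- 1ℤ)) (diag P n)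

  strip : Bool → ℤ → ℤ → ℤ
  strip meets outer inner = ind meets ℤ.* (outer ℤ.- inner)

  ex-central : ex (φterm (+ 0)) ≡ ∑ M (λ c → strip (central c) (a 0 c) (b 0 c))
  ex-central = trans (ex-φbr-⊆ (L 0) (U 0) (λ r → colDec P r r)) (ex-φ (U 0) (L 0))

  ex-upper : ∀ k → ex (φterm (+ suc k)) ≡ ∑ M (λ c → strip (upper k c) (a k c) (a (suc k) c))
  ex-upper k = trans (cong ex (φbr-⊇ (U k) (U (suc k)) (λ r → rowDec P r (k + r)))) (ex-φ (U k) (U (suc k)))

  ex-lower : ∀ k → ex (φterm -[1+ k ]) ≡ ∑ M (λ c → strip (lower k c) (b k c) (b (suc k) c))
  ex-lower k = trans (cong (λ i → ex (φbr Nr M (L (suc i)) (L k))) (ℕP.+-identityʳ k))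
    (trans (ex-φbr-⊆ (L (suc k)) (L k) (λ r → colDec P (suc k + r) r)) (ex-φ (L k) (L (suc k))))

  ex-nonnegative : ex (prodF (map φterm (map +_ (upTo (suc (suc Nr))))))
    ≡ ∑ M (λ c → strip (central c) (a 0 c) (b 0 c)) ℤ.+ ∑ M (λ c → ∑ (suc Nr) (λ k → strip (upper k c) (a k c) (a (suc k) c)))
  ex-nonnegative =
    trans (cong (λ l → ex (prodF (map φterm l))) (map-applyUpTo (λ n → n) +_ (suc (suc Nr))))
      (trans (ex-prodF-map φterm +_ (suc (suc Nr)))
        (cong₂ ℤ._+_ ex-central
          (trans (∑-cong (suc Nr) ex-upper) (∑-swap (suc Nr) M (λ k c → strip (upper k c) (a k c) (a (suc k) c))))))

  ex-negative : ex (prodF (map φterm (map -[1+_] (upTo (suc Nr)))))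
    ≡ ∑ M (λ c → ∑ (suc Nr) (λ k → strip (lower k c) (b k c) (b (suc k) c)))
  ex-negative =
    trans (cong (λ l → ex (prodF (map φterm l))) (map-applyUpTo (λ n → n) -[1+_] (suc Nr)))
      (trans (ex-prodF-map φterm -[1+_] (suc Nr))
        (trans (∑-cong (suc Nr) ex-lower) (∑-swap (suc Nr) M (λ k c → strip (lower k c) (b k c) (b (suc k) c)))))

  first central-term upper-terms lower-terms : ℕ → ℤ
  first c = ℤ.- a 0 c
  central-term c = strip (central c) (a 0 c) (b 0 c)
  upper-terms c = ∑ (suc Nr) (λ k → strip (upper k c) (a k c) (a (suc k) c))
  lower-terms c = ∑ (suc Nr) (λ k → strip (lower k c) (b k c) (b (suc k) c))

  Φ-column : ℕ → ℤ
  Φ-column c = first c ℤ.+ ((central-term c ℤ.+ upper-terms c) ℤ.+ lower-terms c)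

  Φ-side : ex (Φπ P) ≡ ∑ M Φ-column
  Φ-side = begin
      ex (Φπ P)
    ≡⟨ ex-⊗ (invF (bPart Nr M (U 0))) (prodF (map φterm (nonnegative ++ negative))) ⟩
      ex (invF (bPart Nr M (U 0))) ℤ.+ ex (prodF (map φterm (nonnegative ++ negative)))
    ≡⟨ cong₂ ℤ._+_ (trans (ex-inv (bPart Nr M (U 0))) (cong ℤ.-_ (ex-bPart (U 0))))
                   (trans (cong (ex ∘ prodF) (map-++ φterm nonnegative negative))
                          (ex-prodF-++ (map φterm nonnegative) (map φterm negative))) ⟩
      ℤ.- ∑ M (a 0) ℤ.+ (ex (prodF (map φterm nonnegative)) ℤ.+ ex (prodF (map φterm negative)))
    ≡⟨ cong₂ ℤ._+_ (sym (∑-neg M (a 0))) (cong₂ ℤ._+_ ex-nonnegative ex-negative) ⟩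
      ∑ M first ℤ.+ ((∑ M central-term ℤ.+ ∑ M upper-terms) ℤ.+ ∑ M lower-terms)
    ≡⟨ cong (λ z → ∑ M first ℤ.+ (z ℤ.+ ∑ M lower-terms)) (sym (∑-+ M central-term upper-terms)) ⟩
      ∑ M first ℤ.+ (∑ M (λ c → central-term c ℤ.+ upper-terms c) ℤ.+ ∑ M lower-terms)
    ≡⟨ cong (λ z → ∑ M first ℤ.+ z) (sym (∑-+ M _ lower-terms)) ⟩
      ∑ M first ℤ.+ ∑ M (λ c → (central-term c ℤ.+ upper-terms c) ℤ.+ lower-terms c)
    ≡⟨ sym (∑-+ M first _) ⟩
      ∑ M Φ-column
    ∎
    where
    open ≡-Reasoning
    nonnegative = map +_ (upTo (suc (suc Nr)))
    negative = map -[1+_] (upTo (suc Nr))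

  a-far : ∀ k c → Nr ≤ k → a k c ≡ 0ℤ
  a-far k c Nr≤k = ∑-zero Nr (λ r _ → ψ-empty (U k) r c (U-far k r Nr≤k))

  b-far : ∀ k c → Nr ≤ k → b k c ≡ 0ℤ
  b-far k c Nr≤k = ∑-zero Nr (λ r _ → ψ-empty (L k) r c (L-far k r Nr≤k))

  columns-agree : ∀ c → F-column c ≡ Φ-column c
  columns-agree c = begin
      F-column c
    ≡⟨ cong₂ ℤ._+_ (sym (∑-extend Nr (suc Nr) _ (ℕP.n≤1+n Nr) (λ k Nr≤k _ → far-term signU a (a-far k c Nr≤k))))
                   (sym (∑-extend Nr (suc Nr) _ (ℕP.n≤1+n Nr) (λ k Nr≤k _ → far-term signL b (b-far k c Nr≤k)))) ⟩
      (s₀ ℤ.- (1ℤ ℤ.- u₀)) ℤ.* a 0 c ℤ.+ XU ℤ.+ ((l₀ ℤ.- s₀) ℤ.* b 0 c ℤ.+ XL)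
    ≡⟨ regroup s₀ u₀ l₀ (a 0 c) (b 0 c) XU XL (ind (upper Nr c)) (ind (lower Nr c)) ⟩
      ℤ.- a 0 c ℤ.+ ((s₀ ℤ.* (a 0 c ℤ.- b 0 c) ℤ.+ (u₀ ℤ.* a 0 c ℤ.+ XU ℤ.- ind (upper Nr c) ℤ.* 0ℤ))
                   ℤ.+ (l₀ ℤ.* b 0 c ℤ.+ XL ℤ.- ind (lower Nr c) ℤ.* 0ℤ))
    ≡⟨ cong₂ (λ p q → ℤ.- a 0 c ℤ.+ ((s₀ ℤ.* (a 0 c ℤ.- b 0 c) ℤ.+ p) ℤ.+ q))
             (sym (trans (abel Nr (λ k → ind (upper k c)) (λ k → a k c))
                         (cong (λ z → u₀ ℤ.* a 0 c ℤ.+ XU ℤ.- ind (upper Nr c) ℤ.* z) (a-far (suc Nr) c (ℕP.n≤1+n Nr)))))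
             (sym (trans (abel Nr (λ k → ind (lower k c)) (λ k → b k c))
                         (cong (λ z → l₀ ℤ.* b 0 c ℤ.+ XL ℤ.- ind (lower Nr c) ℤ.* z) (b-far (suc Nr) c (ℕP.n≤1+n Nr))))) ⟩
      Φ-column c
    ∎
    where
    open ≡-Reasoning
    s₀ = ind (central c)
    u₀ = ind (upper 0 c)
    l₀ = ind (lower 0 c)
    XU = ∑ Nr (λ k → (ind (upper (suc k) c) ℤ.- ind (upper k c)) ℤ.* a (suc k) c)
    XL = ∑ Nr (λ k → (ind (lower (suc k) c) ℤ.- ind (lower k c)) ℤ.* b (suc k) c)
    far-term : ∀ (sign e : ℕ → ℕ → ℤ) {k} → e k c ≡ 0ℤ → sign k c ℤ.* e k c ≡ 0ℤ
    far-term sign e {k} e≡0 rewrite e≡0 = ℤP.*-zeroʳ (sign k c)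
    regroup : ∀ s₀ u₀ l₀ a₀ b₀ XU XL uN lN →
      (s₀ ℤ.- (1ℤ ℤ.- u₀)) ℤ.* a₀ ℤ.+ XU ℤ.+ ((l₀ ℤ.- s₀) ℤ.* b₀ ℤ.+ XL)
      ≡ ℤ.- a₀ ℤ.+ ((s₀ ℤ.* (a₀ ℤ.- b₀) ℤ.+ (u₀ ℤ.* a₀ ℤ.+ XU ℤ.- uN ℤ.* 0ℤ)) ℤ.+ (l₀ ℤ.* b₀ ℤ.+ XL ℤ.- lN ℤ.* 0ℤ))
    regroup = solve-∀

  exponents-agree : ex (Fπ P) ≡ ex (Φπ P)
  exponents-agree = trans F-side (trans (∑-cong M columns-agree) (sym Φ-side))


mainTheorem6 : (P : PlanePartition) → Fπ P ≈F Φπ P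
mainTheorem6 P = FactorCounting.≈F-by-exponent (Fπ P) (Φπ P) (Assembly.exponents-agree P)
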